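{- For every integer $n\ge1$, $\mathrm{pk}_n(132,231)=\mathrm{pk}_n(132,312)=\mathrm{pk}_n(231,312)=\frac12(n+1)!$.
   Context: For a positive integer $n$, $[n]=\{1,\dots,n\}$. A function $f:[n]\to[n]$ is a parking function if for every $i\in[n]$, $|\{j\in[n]: f(j)\le i\}|\ge i$ (equivalently, in the usual car-parking process where car $i$ prefers spot $f(i)$ and takes the first free spot at or after it, all cars park). The parking permutation $\rho_f\in S_n$ is defined by: spot $i$ is occupied by car $\rho_f(i)$. A permutation $\pi\in S_n$ contains $\sigma\in S_m$ as a pattern if there exist $1\le i_1<\dots<i_m\le n$ with $\pi(i_a)<\pi(i_b)$ iff $\sigma(a)<\sigma(b)$ for all $a,b$; otherwise it avoids $\sigma$. $\mathrm{pk}_n(\sigma_1,\dots,\sigma_k)$ is the number of parking functions $f:[n]\to[n]$ with $\rho_f$ avoiding every $\sigma_i$. -}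

module Defs where

open import Data.Nat using (ℕ; zero; suc; _+_; _*_; _≤ᵇ_; _<ᵇ_)
open import Data.Bool using (Bool; true; false; _∧_; if_then_else_; not)
open import Data.Bool using () renaming (_≟_ to _≟ᵇ_)
open import Data.Maybe using (Maybe; just; nothing; is-nothing; fromMaybe)
open import Data.Fin using (Fin; toℕ)
open import Data.Vec using (Vec; []; _∷_; lookup)
open import Data.List using (List; []; _∷_; map; filter; length; concatMap; foldl; replicate; upTo; allFin)
open import Relation.Nullary.Decidable using (⌊_⌋)
open import Data.Bool.ListAction using (all; any)

-- Conventions: [n] is represented by Fin n (0-indexed: spot/car i+1 of the
-- paper is the element i of Fin n).

allVecs : (n k : ℕ) → List (Vec (Fin n) k)
allVecs n zero    = [] ∷ []
allVecs n (suc k) = concatMap (λ x → map (x ∷_) (allVecs n k)) (allFin n)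

countB : {A : Set} → (A → Bool) → List A → ℕ
countB p []       = 0
countB p (x ∷ xs) = if p x then suc (countB p xs) else countB p xs

-- parking function: for every i ∈ [n], |{j : f(j) ≤ i}| ≥ i
-- (0-indexed: for every i < n, |{j : f(j) ≤ i}| ≥ i + 1)
isParking : {n : ℕ} → Vec (Fin n) n → Bool
isParking {n} f =
  all (λ i → suc (toℕ i) ≤ᵇ countB (λ j → toℕ (lookup f j) ≤ᵇ toℕ i) (allFin n))
      (allFin n)

-- one step of the parking process: car c prefers spot p and takes the first
-- free spot at or after p (if none, the car leaves and the list is unchanged)
parkCar : ℕ → ℕ → List (Maybe ℕ) → List (Maybe ℕ)
parkCar p       c []             = []
parkCar zero    c (nothing ∷ xs) = just c ∷ xs
parkCar zero    c (just d ∷ xs)  = just d ∷ parkCar zero c xs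
parkCar (suc p) c (x ∷ xs)       = x ∷ parkCar p c xs

-- run cars 0,1,…,n-1 in order starting from the empty lot with n spots;
-- the result lists, for each spot, the car parked there (if any)
parkAll : {n : ℕ} → Vec (Fin n) n → List (Maybe ℕ)
parkAll {n} f =
  foldl (λ lot j → parkCar (toℕ (lookup f j)) (toℕ j) lot)
        (replicate n nothing) (allFin n)

-- parking permutation ρ_f as the list (ρ_f(1), …, ρ_f(n)) (0-indexed cars).
-- For a parking function every spot is occupied, so the default 0 is never used.
parkingPerm : {n : ℕ} → Vec (Fin n) n → List ℕ
parkingPerm f = map (fromMaybe 0) (parkAll f)

subseqs : {A : Set} → List A → List (List A)
subseqs []       = [] ∷ []
subseqs (x ∷ xs) = let r = subseqs xs in map (x ∷_) r Data.List.++ r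

lookupL : List ℕ → ℕ → ℕ
lookupL []       i       = 0
lookupL (x ∷ xs) zero    = x
lookupL (x ∷ xs) (suc i) = lookupL xs i

orderIso : List ℕ → List ℕ → Bool
orderIso xs ys =
  ⌊ length xs Data.Nat.≟ length ys ⌋ ∧
  all (λ a → all (λ b → ⌊ (lookupL xs a <ᵇ lookupL xs b) ≟ᵇ (lookupL ys a <ᵇ lookupL ys b) ⌋)
                 (upTo (length xs)))
      (upTo (length xs))

contains : List ℕ → List ℕ → Bool
contains π σ = any (λ s → orderIso s σ) (subseqs π)

avoids : List ℕ → List ℕ → Bool
avoids π σ = not (contains π σ)

pk : (n : ℕ) → List (List ℕ) → ℕ
pk n σs = countB (λ f → isParking f ∧ all (avoids (parkingPerm f)) σs) (allVecs n n)

p132 p231 p312 : List ℕ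
p132 = 1 ∷ 3 ∷ 2 ∷ []
p231 = 2 ∷ 3 ∷ 1 ∷ []
p312 = 3 ∷ 1 ∷ 2 ∷ []

private
  open import Relation.Binary.PropositionalEquality using (_≡_; refl)
  t1 : pk 1 (p132 ∷ p231 ∷ []) ≡ 1
  t1 = refl
  t2 : pk 3 (p132 ∷ p231 ∷ []) ≡ 12
  t2 = refl
  t3 : pk 3 [] ≡ 16
  t3 = refl
  t4 : pk 3 (p231 ∷ p312 ∷ []) ≡ 12
  t4 = refl
  t5 : pk 4 (p132 ∷ p312 ∷ []) ≡ 60
  t5 = refl
  t6 : pk 4 [] ≡ 125
  t6 = refl

module Submission where

open import Defs
open import Data.Nat using (ℕ; suc; _≤_; _/_; _!)
open import Data.List using (List; []; _∷_)
open import Data.Product using (_×_)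
open import Relation.Binary.PropositionalEquality using (_≡_)

open import Data.Bool using (Bool; true; false; T; not; _∧_)
open import Data.Bool using () renaming (_≟_ to _≟ᵇ_)
open import Data.Bool.ListAction using (all; any)
open import Data.Bool.Properties using (T-≡; T-∧; ∧-zeroʳ)
open import Data.Fin as Fin using (Fin; toℕ; fromℕ<)
open import Data.Fin.Properties using (toℕ<n; toℕ-fromℕ<)
open import Data.List using (_++_; map; length; foldl; replicate; tabulate; allFin; concat; concatMap; upTo)
open import Data.List.Membership.Propositional using (_∈_; find; lose)
open import Data.List.Membership.Propositional.Properties using (∈-map⁺; ∈-map⁻; ∈-++⁺ˡ; ∈-++⁺ʳ; ∈-++⁻)
open import Data.List.Properties
  using (++-assoc; ++-identityʳ; foldl-cong; foldl-map; length-++; length-map; length-replicate; map-++; map-tabulate)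
open import Data.List.Relation.Binary.Sublist.Propositional using (_⊆_; []; _∷_; _∷ʳ_; to∈; from∈; ⊆-refl; ⊆-trans)
open import Data.List.Relation.Binary.Sublist.Propositional.Properties using (++⁺; ++⁺ˡ; ∷ˡ⁻)
open import Data.List.Relation.Unary.All as All using (All; []; _∷_)
open import Data.List.Relation.Unary.All.Properties as All using (all⁺; all⁻; applyUpTo⁻; tabulate⁺; tabulate⁻)
open import Data.List.Relation.Unary.Any as Any using (Any; here; there)
open import Data.List.Relation.Unary.Any.Properties using (any⁺; any⁻)
open import Data.Maybe using (Maybe; just; nothing; fromMaybe; is-just; is-nothing)
open import Data.Nat
open import Data.Nat.DivMod using (m*n/n≡m)
open import Data.Nat.Properties
open import Algebra.Properties.CommutativeSemigroup +-commutativeSemigroup using (interchange; x∙yz≈y∙xz)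
open import Data.Nat.Tactic.RingSolver using (solve-∀)
open import Data.Product using (∃; _,_; proj₁; proj₂)
open import Data.Sum using (_⊎_; inj₁; inj₂; [_,_]′)
open import Data.Vec using (Vec; []; _∷_; lookup; toList)
open import Function using (_∘_; id; Equivalence)
open import Relation.Binary.PropositionalEquality
open import Relation.Nullary using (¬_; contradiction)
open import Relation.Nullary.Decidable using (⌊_⌋; toWitness)

-- For a partly filled lot L whose next car is c, let
-- completions L c k count the preference vectors of the k cars still to come that
-- fill the lot with a pattern-avoiding parking permutation: pk n is this count for
-- the empty lot, and letting one more car arrive turns it into a sum over that
-- car's preference.  Parked cars never move and later cars are larger, so a lot is
-- dead as soon as it has more holes than cars to come, or a hole that forms a
-- forbidden pattern with two parked cars whichever larger car fills it.  Hence, for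
-- each pair of patterns, only lots of a few shapes survive, and their counts obey
-- recursions with closed forms:
--   {132, 231}: the parked cars form one block and each car parks at either end of
--     it, so a holes left and r holes right of a block of m cars give vCount a m r;
--   {231, 312}: the parked cars fill a prefix, except for at most one gap just left
--     of a descending block, and the gap is filled from right to left;
--   {132, 312}: each car parks left of all earlier ones until spot 0 is taken;
--     from then on each car takes the leftmost hole, which i + 1 preferences lead
--     to when it is spot i.
-- In all three cases the total is 3 · 4 ⋯ (n + 1) = (n + 1)! / 2.


-- Arithmetic and finite sums

<⇒∃+suc : ∀ {p a} → p < a → ∃ λ d → a ≡ p + suc d
<⇒∃+suc {p} p<a with m≤n⇒∃[o]m+o≡n p<a
... | d , eq = d , trans (sym eq) (sym (+-suc p d))

sumBelow : ℕ → (ℕ → ℕ) → ℕ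
sumBelow zero    h = 0
sumBelow (suc k) h = h 0 + sumBelow k (h ∘ suc)

sumBelow-cong : ∀ k {g h : ℕ → ℕ} → (∀ i → i < k → g i ≡ h i) → sumBelow k g ≡ sumBelow k h
sumBelow-cong zero    eq = refl
sumBelow-cong (suc k) eq = cong₂ _+_ (eq 0 z<s) (sumBelow-cong k (λ i i<k → eq (suc i) (s<s i<k)))

sumBelow-+ : ∀ a b h → sumBelow (a + b) h ≡ sumBelow a h + sumBelow b (λ i → h (a + i))
sumBelow-+ zero    b h = refl
sumBelow-+ (suc a) b h = trans (cong (h 0 +_) (sumBelow-+ a b (h ∘ suc))) (sym (+-assoc (h 0) _ _))

sumBelow-suc : ∀ k h → sumBelow (suc k) h ≡ sumBelow k h + h k
sumBelow-suc zero    h = +-comm (h 0) 0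
sumBelow-suc (suc k) h = trans (cong (h 0 +_) (sumBelow-suc k (h ∘ suc))) (sym (+-assoc (h 0) _ _))

sumBelow-const : ∀ k v → sumBelow k (λ _ → v) ≡ k * v
sumBelow-const zero    v = refl
sumBelow-const (suc k) v = cong (v +_) (sumBelow-const k v)

sumBelow-zero : ∀ k → sumBelow k (λ _ → 0) ≡ 0
sumBelow-zero k = trans (sumBelow-const k 0) (*-zeroʳ k)

sumBelow-*ˡ : ∀ k c h → sumBelow k (λ i → c * h i) ≡ c * sumBelow k h
sumBelow-*ˡ zero    c h = sym (*-zeroʳ c)
sumBelow-*ˡ (suc k) c h =
  trans (cong (c * h 0 +_) (sumBelow-*ˡ k c (h ∘ suc))) (sym (*-distribˡ-+ c (h 0) _))

sumBelow-block : ∀ a b h {v} → (∀ i → i < a → h i ≡ v) → (∀ j → j < b → h (a + j) ≡ 0) →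
                 sumBelow (a + b) h ≡ a * v
sumBelow-block a b h {v} first rest = begin
  sumBelow (a + b) h                                  ≡⟨ sumBelow-+ a b h ⟩
  sumBelow a h + sumBelow b (λ j → h (a + j))         ≡⟨ cong₂ _+_ (sumBelow-cong a first) (sumBelow-cong b rest) ⟩
  sumBelow a (λ _ → v) + sumBelow b (λ _ → 0)         ≡⟨ cong₂ _+_ (sumBelow-const a v) (sumBelow-zero b) ⟩
  a * v + 0                                           ≡⟨ +-identityʳ _ ⟩
  a * v                                               ∎
  where open ≡-Reasoning

sumBelow-last : ∀ a h → (∀ i → i < a → h i ≡ 0) → sumBelow (suc a) h ≡ h a
sumBelow-last a h zeros = begin
  sumBelow (suc a) h          ≡⟨ sumBelow-suc a h ⟩
  sumBelow a h + h a          ≡⟨ cong (_+ h a) (sumBelow-cong a zeros) ⟩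
  sumBelow a (λ _ → 0) + h a  ≡⟨ cong (_+ h a) (sumBelow-zero a) ⟩
  h a                         ∎
  where open ≡-Reasoning

sumAntidiagonal : ℕ → (ℕ → ℕ → ℕ) → ℕ
sumAntidiagonal zero    g = g 0 0
sumAntidiagonal (suc k) g = g 0 (suc k) + sumAntidiagonal k (g ∘ suc)

sumAntidiagonal-cong : ∀ k {g h : ℕ → ℕ → ℕ} → (∀ a r → g a r ≡ h a r) →
                       sumAntidiagonal k g ≡ sumAntidiagonal k h
sumAntidiagonal-cong zero    eq = eq 0 0
sumAntidiagonal-cong (suc k) eq = cong₂ _+_ (eq 0 (suc k)) (sumAntidiagonal-cong k (eq ∘ suc))

sumAntidiagonal-+ : ∀ k g h → sumAntidiagonal k (λ a r → g a r + h a r) ≡ sumAntidiagonal k g + sumAntidiagonal k h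
sumAntidiagonal-+ zero    g h = refl
sumAntidiagonal-+ (suc k) g h =
  trans (cong (g 0 (suc k) + h 0 (suc k) +_) (sumAntidiagonal-+ k (g ∘ suc) (h ∘ suc)))
        (interchange (g 0 (suc k)) (h 0 (suc k)) _ _)

sumAntidiagonal-*ˡ : ∀ k c g → sumAntidiagonal k (λ a r → c * g a r) ≡ c * sumAntidiagonal k g
sumAntidiagonal-*ˡ zero    c g = refl
sumAntidiagonal-*ˡ (suc k) c g =
  trans (cong (c * g 0 (suc k) +_) (sumAntidiagonal-*ˡ k c (g ∘ suc))) (sym (*-distribˡ-+ c _ _))

sumAntidiagonal-zero : ∀ k → sumAntidiagonal k (λ _ _ → 0) ≡ 0
sumAntidiagonal-zero zero    = refl
sumAntidiagonal-zero (suc k) = sumAntidiagonal-zero k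

sumAntidiagonal-suc : ∀ k g → sumAntidiagonal (suc k) g ≡ sumAntidiagonal k (λ a r → g a (suc r)) + g (suc k) 0
sumAntidiagonal-suc zero    g = refl
sumAntidiagonal-suc (suc k) g =
  trans (cong (g 0 (suc (suc k)) +_) (sumAntidiagonal-suc k (g ∘ suc))) (sym (+-assoc (g 0 (suc (suc k))) _ _))

sumAntidiagonal-sumBelow : ∀ k g → sumAntidiagonal k g ≡ sumBelow (suc k) (λ a → g a (k ∸ a))
sumAntidiagonal-sumBelow zero    g = sym (+-identityʳ _)
sumAntidiagonal-sumBelow (suc k) g = cong (g 0 (suc k) +_) (sumAntidiagonal-sumBelow k (g ∘ suc))


-- Rising factorials

_↑_ : ℕ → ℕ → ℕ
a ↑ zero  = 1
a ↑ suc k = a * suc a ↑ k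

↑-suc : ∀ a k → a ↑ suc k ≡ a ↑ k * (a + k)
↑-suc a zero    = trans (*-identityʳ a) (trans (sym (+-identityʳ a)) (sym (*-identityˡ _)))
↑-suc a (suc k) = begin
  a * (suc a ↑ suc k)          ≡⟨ cong (a *_) (↑-suc (suc a) k) ⟩
  a * (suc a ↑ k * (suc a + k)) ≡⟨ sym (*-assoc a _ _) ⟩
  a ↑ suc k * (suc a + k)       ≡⟨ cong (a ↑ suc k *_) (sym (+-suc a k)) ⟩
  a ↑ suc k * (a + suc k)       ∎
  where open ≡-Reasoning

↑-+ : ∀ a m j → a ↑ (m + j) ≡ a ↑ m * (a + m) ↑ j
↑-+ a zero    j = trans (cong (_↑ j) (sym (+-identityʳ a))) (sym (+-identityʳ _))
↑-+ a (suc m) j = begin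
  a * suc a ↑ (m + j)                  ≡⟨ cong (a *_) (↑-+ (suc a) m j) ⟩
  a * (suc a ↑ m * (suc a + m) ↑ j)    ≡⟨ *-assoc a _ _ ⟨
  a ↑ suc m * (suc a + m) ↑ j          ≡⟨ cong (λ x → a ↑ suc m * x ↑ j) (+-suc a m) ⟨
  a ↑ suc m * (a + suc m) ↑ j          ∎
  where open ≡-Reasoning

!*↑ : ∀ a k → a ! * suc a ↑ k ≡ (a + k) !
!*↑ a zero    = trans (*-identityʳ _) (cong _! (sym (+-identityʳ a)))
!*↑ a (suc k) = begin
  a ! * (suc a * suc (suc a) ↑ k) ≡⟨ sym (*-assoc (a !) (suc a) _) ⟩
  a ! * suc a * suc (suc a) ↑ k   ≡⟨ cong (_* suc (suc a) ↑ k) (*-comm (a !) (suc a)) ⟩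
  suc a ! * suc (suc a) ↑ k       ≡⟨ !*↑ (suc a) k ⟩
  (suc a + k) !                   ≡⟨ cong _! (sym (+-suc a k)) ⟩
  (a + suc k) !                   ∎
  where open ≡-Reasoning

[2+k]!/2≡3↑k : ∀ k → (2 + k) ! / 2 ≡ 3 ↑ k
[2+k]!/2≡3↑k k = trans (cong (_/ 2) (sym (trans (*-comm (3 ↑ k) 2) (!*↑ 2 k)))) (m*n/n≡m (3 ↑ k) 2)

sumBelow-2↑-3↑ : ∀ q h x → h 0 ≡ 2 ↑ q * x → (∀ p → p < q → h (suc p) ≡ 3 ↑ pred q * x) →
                 sumBelow (suc q) h ≡ 3 ↑ q * x
sumBelow-2↑-3↑ zero    h x first rest = trans (+-identityʳ (h 0)) first
sumBelow-2↑-3↑ (suc q) h x first rest = begin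
  h 0 + sumBelow (suc q) (h ∘ suc)          ≡⟨ cong₂ _+_ first (sumBelow-cong (suc q) rest) ⟩
  2 ↑ suc q * x + sumBelow (suc q) (λ _ → 3 ↑ q * x) ≡⟨ cong (2 ↑ suc q * x +_) (sumBelow-const (suc q) _) ⟩
  2 ↑ suc q * x + suc q * (3 ↑ q * x)       ≡⟨ arith (3 ↑ q) q x ⟩
  3 ↑ q * (3 + q) * x                       ≡⟨ cong (_* x) (↑-suc 3 q) ⟨
  3 ↑ suc q * x                             ∎
  where
  open ≡-Reasoning
  arith : ∀ y q x → 2 * y * x + suc q * (y * x) ≡ y * (3 + q) * x
  arith = solve-∀


module _ {A : Set} (p : A → Bool) where

  countB-++ : ∀ xs ys → countB p (xs ++ ys) ≡ countB p xs + countB p ys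
  countB-++ []       ys = refl
  countB-++ (x ∷ xs) ys with p x
  ... | true  = cong suc (countB-++ xs ys)
  ... | false = countB-++ xs ys

  countB-zero : (∀ x → p x ≡ false) → ∀ xs → countB p xs ≡ 0
  countB-zero none []       = refl
  countB-zero none (x ∷ xs) rewrite none x = countB-zero none xs

  countB-concatMap-allFin : ∀ n (g : Fin n → List A) (φ : ℕ → ℕ) → (∀ i → countB p (g i) ≡ φ (toℕ i)) →
                            countB p (concatMap g (allFin n)) ≡ sumBelow n φ
  countB-concatMap-allFin zero    g φ eq = refl
  countB-concatMap-allFin (suc n) g φ eq = begin
    countB p (g Fin.zero ++ concatMap g (tabulate Fin.suc))
      ≡⟨ countB-++ (g Fin.zero) _ ⟩
    countB p (g Fin.zero) + countB p (concatMap g (tabulate Fin.suc))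
      ≡⟨ cong₂ _+_ (eq Fin.zero)
           (cong (countB p ∘ concat) (trans (map-tabulate Fin.suc g) (sym (map-tabulate id (g ∘ Fin.suc))))) ⟩
    φ 0 + countB p (concatMap (g ∘ Fin.suc) (allFin n))
      ≡⟨ cong (φ 0 +_) (countB-concatMap-allFin n (g ∘ Fin.suc) (φ ∘ suc) (eq ∘ Fin.suc)) ⟩
    φ 0 + sumBelow n (φ ∘ suc) ∎
    where open ≡-Reasoning

module _ {A B : Set} where

  countB-map : ∀ (p : B → Bool) (g : A → B) xs → countB p (map g xs) ≡ countB (p ∘ g) xs
  countB-map p g []       = refl
  countB-map p g (x ∷ xs) with p (g x)
  ... | true  = cong suc (countB-map p g xs)
  ... | false = countB-map p g xs

module _ {A : Set} where

  countB-cong : ∀ {p q : A → Bool} → (∀ x → p x ≡ q x) → ∀ xs → countB p xs ≡ countB q xs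
  countB-cong eq []       = refl
  countB-cong {q = q} eq (x ∷ xs) rewrite eq x with q x
  ... | true  = cong suc (countB-cong eq xs)
  ... | false = countB-cong eq xs

  countB-lookup : ∀ {m} (p : A → Bool) (v : Vec A m) → countB (p ∘ lookup v) (allFin m) ≡ countB p (toList v)
  countB-lookup p v = begin
    countB (p ∘ lookup v) (allFin _)   ≡⟨ sym (countB-map p (lookup v) (allFin _)) ⟩
    countB p (map (lookup v) (allFin _)) ≡⟨ cong (countB p) (map-tabulate id (lookup v)) ⟩
    countB p (tabulate (lookup v))     ≡⟨ cong (countB p) (tabulate-lookup v) ⟩
    countB p (toList v)                ∎
    where
    open ≡-Reasoning
    tabulate-lookup : ∀ {m} (v : Vec A m) → tabulate (lookup v) ≡ toList v
    tabulate-lookup []       = refl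
    tabulate-lookup (x ∷ xs) = cong (x ∷_) (tabulate-lookup xs)


-- Lots and the parking process

Lot : Set
Lot = List (Maybe ℕ)

holes : ℕ → Lot
holes k = replicate k nothing

cars : List ℕ → Lot
cars = map just

parked : Lot → List ℕ
parked []            = []
parked (just x ∷ L)  = x ∷ parked L
parked (nothing ∷ L) = parked L

lotPerm : Lot → List ℕ
lotPerm = map (fromMaybe 0)

countParked : Lot → ℕ
countParked []            = 0
countParked (just x ∷ L)  = suc (countParked L)
countParked (nothing ∷ L) = countParked L

countHoles : Lot → ℕ
countHoles []            = 0
countHoles (just x ∷ L)  = countHoles L
countHoles (nothing ∷ L) = suc (countHoles L)

length≡countParked+countHoles : ∀ L → length L ≡ countParked L + countHoles L
length≡countParked+countHoles []            = refl
length≡countParked+countHoles (just x ∷ L)  = cong suc (length≡countParked+countHoles L)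
length≡countParked+countHoles (nothing ∷ L) = trans (cong suc (length≡countParked+countHoles L)) (sym (+-suc _ _))

parkFrom : ∀ {n k} → Lot → ℕ → Vec (Fin n) k → Lot
parkFrom L c []       = L
parkFrom L c (p ∷ ps) = parkFrom (parkCar (toℕ p) c L) (suc c) ps

isFull : Lot → Bool
isFull = all is-just

parkAll≡parkFrom : ∀ {n} (f : Vec (Fin n) n) → parkAll f ≡ parkFrom (holes n) 0 f
parkAll≡parkFrom f = foldl-parkCar f 0 _
  where
  step : ∀ {n m} → Vec (Fin n) m → ℕ → Lot → Fin m → Lot
  step f c lot j = parkCar (toℕ (lookup f j)) (c + toℕ j) lot

  foldl-parkCar : ∀ {n m} (f : Vec (Fin n) m) c L → foldl (step f c) L (allFin m) ≡ parkFrom L c f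
  foldl-parkCar []                    c L = refl
  foldl-parkCar {m = suc m} (p ∷ ps) c L = begin
    foldl (step (p ∷ ps) c) L′ (tabulate Fin.suc)
      ≡⟨ cong (foldl (step (p ∷ ps) c) L′) (map-tabulate id Fin.suc) ⟨
    foldl (step (p ∷ ps) c) L′ (map Fin.suc (allFin m))
      ≡⟨ foldl-map (step (p ∷ ps) c) Fin.suc L′ (allFin m) ⟩
    foldl (λ lot j → step (p ∷ ps) c lot (Fin.suc j)) L′ (allFin m)
      ≡⟨ foldl-cong (λ lot j → cong (λ d → parkCar (toℕ (lookup ps j)) d lot) (+-suc c (toℕ j))) L′ (allFin m) ⟩
    foldl (step ps (suc c)) L′ (allFin m)
      ≡⟨ cong (λ d → foldl (step ps (suc c)) (parkCar (toℕ p) d L) (allFin m)) (+-identityʳ c) ⟩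
    foldl (step ps (suc c)) (parkCar (toℕ p) c L) (allFin m)
      ≡⟨ foldl-parkCar ps (suc c) (parkCar (toℕ p) c L) ⟩
    parkFrom L c (p ∷ ps) ∎
    where
    open ≡-Reasoning
    L′ = parkCar (toℕ p) (c + 0) L

length-parkCar : ∀ p c L → length (parkCar p c L) ≡ length L
length-parkCar p       c []            = refl
length-parkCar zero    c (nothing ∷ L) = refl
length-parkCar zero    c (just d ∷ L)  = cong suc (length-parkCar zero c L)
length-parkCar (suc p) c (s ∷ L)       = cong suc (length-parkCar p c L)

length-parkFrom : ∀ {n k} (ps : Vec (Fin n) k) c L → length (parkFrom L c ps) ≡ length L
length-parkFrom []       c L = refl
length-parkFrom (p ∷ ps) c L = trans (length-parkFrom ps (suc c) _) (length-parkCar (toℕ p) c L)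


-- Parking functions are the preference vectors that fill the lot

indicator : Bool → ℕ
indicator true  = 1
indicator false = 0

occupiedUpTo : ℕ → Lot → ℕ
occupiedUpTo i       []      = 0
occupiedUpTo zero    (s ∷ L) = indicator (is-just s)
occupiedUpTo (suc i) (s ∷ L) = indicator (is-just s) + occupiedUpTo i L

vacant : ℕ → Lot → Bool
vacant i       []      = false
vacant zero    (s ∷ L) = is-nothing s
vacant (suc i) (s ∷ L) = vacant i L

prefsUpTo : ∀ {n k} → ℕ → Vec (Fin n) k → ℕ
prefsUpTo i ps = countB (λ p → toℕ p ≤ᵇ i) (toList ps)

private
  ≤ᵇ-suc : ∀ p i → (suc p ≤ᵇ suc i) ≡ (p ≤ᵇ i)
  ≤ᵇ-suc zero    i = refl
  ≤ᵇ-suc (suc p) i = refl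

parkCar-occupiedUpTo : ∀ p c L i → occupiedUpTo i (parkCar p c L) ≤ indicator (p ≤ᵇ i) + occupiedUpTo i L
parkCar-occupiedUpTo p       c []             i       = z≤n
parkCar-occupiedUpTo zero    c (nothing ∷ L)  zero    = ≤-refl
parkCar-occupiedUpTo zero    c (nothing ∷ L)  (suc i) = ≤-refl
parkCar-occupiedUpTo zero    c (just d ∷ L)   zero    = s≤s z≤n
parkCar-occupiedUpTo zero    c (just d ∷ L)   (suc i) = s≤s (parkCar-occupiedUpTo zero c L i)
parkCar-occupiedUpTo (suc p) c (s ∷ L)        zero    = ≤-refl
parkCar-occupiedUpTo (suc p) c (s ∷ L)        (suc i) rewrite ≤ᵇ-suc p i = begin
  indicator (is-just s) + occupiedUpTo i (parkCar p c L)
    ≤⟨ +-monoʳ-≤ _ (parkCar-occupiedUpTo p c L i) ⟩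
  indicator (is-just s) + (indicator (p ≤ᵇ i) + occupiedUpTo i L)
    ≡⟨ x∙yz≈y∙xz (indicator (is-just s)) (indicator (p ≤ᵇ i)) (occupiedUpTo i L) ⟩
  indicator (p ≤ᵇ i) + (indicator (is-just s) + occupiedUpTo i L)   ∎
  where open ≤-Reasoning

parkCar-vacant : ∀ p c L i → vacant i (parkCar p c L) ≡ true →
  vacant i L ≡ true × occupiedUpTo i (parkCar p c L) ≡ indicator (p ≤ᵇ i) + occupiedUpTo i L
parkCar-vacant p       c []            i       ()
parkCar-vacant zero    c (nothing ∷ L) zero    ()
parkCar-vacant zero    c (nothing ∷ L) (suc i) v = v , refl
parkCar-vacant zero    c (just d ∷ L)  zero    ()
parkCar-vacant zero    c (just d ∷ L)  (suc i) v with parkCar-vacant zero c L i v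
... | v′ , eq = v′ , cong suc eq
parkCar-vacant (suc p) c (s ∷ L)       zero    v = v , refl
parkCar-vacant (suc p) c (s ∷ L)       (suc i) v with parkCar-vacant p c L i v
... | v′ , eq rewrite ≤ᵇ-suc p i =
  v′ , trans (cong (indicator (is-just s) +_) eq)
             (x∙yz≈y∙xz (indicator (is-just s)) (indicator (p ≤ᵇ i)) (occupiedUpTo i L))

private
  prefsUpTo-∷ : ∀ {n k} i (p : Fin n) (ps : Vec (Fin n) k) L →
    prefsUpTo i ps + (indicator (toℕ p ≤ᵇ i) + occupiedUpTo i L) ≡ prefsUpTo i (p ∷ ps) + occupiedUpTo i L
  prefsUpTo-∷ i p ps L with toℕ p ≤ᵇ i
  ... | true  = +-suc (prefsUpTo i ps) (occupiedUpTo i L)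
  ... | false = refl

parkFrom-occupiedUpTo : ∀ {n k} (ps : Vec (Fin n) k) c L i →
  occupiedUpTo i (parkFrom L c ps) ≤ prefsUpTo i ps + occupiedUpTo i L
parkFrom-occupiedUpTo []       c L i = ≤-refl
parkFrom-occupiedUpTo (p ∷ ps) c L i = begin
  occupiedUpTo i (parkFrom L′ (suc c) ps)                     ≤⟨ parkFrom-occupiedUpTo ps (suc c) L′ i ⟩
  prefsUpTo i ps + occupiedUpTo i L′                          ≤⟨ +-monoʳ-≤ (prefsUpTo i ps) (parkCar-occupiedUpTo (toℕ p) c L i) ⟩
  prefsUpTo i ps + (indicator (toℕ p ≤ᵇ i) + occupiedUpTo i L) ≡⟨ prefsUpTo-∷ i p ps L ⟩
  prefsUpTo i (p ∷ ps) + occupiedUpTo i L                      ∎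
  where
  open ≤-Reasoning
  L′ = parkCar (toℕ p) c L

parkFrom-vacant : ∀ {n k} (ps : Vec (Fin n) k) c L i → vacant i (parkFrom L c ps) ≡ true →
  vacant i L ≡ true × occupiedUpTo i (parkFrom L c ps) ≡ prefsUpTo i ps + occupiedUpTo i L
parkFrom-vacant []       c L i v = v , refl
parkFrom-vacant (p ∷ ps) c L i v with parkFrom-vacant ps (suc c) (parkCar (toℕ p) c L) i v
... | v′ , eq with parkCar-vacant (toℕ p) c L i v′
... | v″ , eq′ = v″ , trans eq (trans (cong (prefsUpTo i ps +_) eq′) (prefsUpTo-∷ i p ps L))

occupiedUpTo-holes : ∀ k i → occupiedUpTo i (holes k) ≡ 0
occupiedUpTo-holes zero    i       = refl
occupiedUpTo-holes (suc k) zero    = refl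
occupiedUpTo-holes (suc k) (suc i) = occupiedUpTo-holes k i

isFull⇒occupiedUpTo : ∀ L → isFull L ≡ true → ∀ {i} → i < length L → occupiedUpTo i L ≡ suc i
isFull⇒occupiedUpTo (just x ∷ L)  full {zero}  _          = refl
isFull⇒occupiedUpTo (just x ∷ L)  full {suc i} (s≤s i<l) = cong suc (isFull⇒occupiedUpTo L full i<l)
isFull⇒occupiedUpTo (nothing ∷ L) ()

vacant⇒occupiedUpTo : ∀ L i → vacant i L ≡ true → occupiedUpTo i L ≤ i
vacant⇒occupiedUpTo (nothing ∷ L) zero    v = z≤n
vacant⇒occupiedUpTo (nothing ∷ L) (suc i) v = m≤n⇒m≤1+n (vacant⇒occupiedUpTo L i v)
vacant⇒occupiedUpTo (just x ∷ L)  (suc i) v = s≤s (vacant⇒occupiedUpTo L i v)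

¬isFull⇒vacant : ∀ L → isFull L ≡ false → ∃ λ i → i < length L × vacant i L ≡ true
¬isFull⇒vacant (nothing ∷ L) _ = zero , z<s , refl
¬isFull⇒vacant (just x ∷ L) nf with ¬isFull⇒vacant L nf
... | i , i<l , v = suc i , s<s i<l , v

module _ {n} (f : Vec (Fin n) n) where

  private
    criterion : Fin n → Bool
    criterion i = suc (toℕ i) ≤ᵇ countB (λ j → toℕ (lookup f j) ≤ᵇ toℕ i) (allFin n)

    criterion≡ : ∀ i → criterion i ≡ (suc (toℕ i) ≤ᵇ prefsUpTo (toℕ i) f)
    criterion≡ i = cong (suc (toℕ i) ≤ᵇ_) (countB-lookup (λ p → toℕ p ≤ᵇ toℕ i) f)

    F : Lot
    F = parkFrom (holes n) 0 f

    length-F : length F ≡ n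
    length-F = trans (length-parkFrom f 0 (holes n)) (length-replicate n)

  isParking-true : (∀ i → suc (toℕ i) ≤ prefsUpTo (toℕ i) f) → isParking f ≡ true
  isParking-true ok = Equivalence.to T-≡ (all⁻ criterion (tabulate⁺ λ i →
    subst T (sym (criterion≡ i)) (≤⇒≤ᵇ (ok i))))

  isParking-false : ∀ i → ¬ suc (toℕ i) ≤ prefsUpTo (toℕ i) f → isParking f ≡ false
  isParking-false i bad with isParking f in eq
  ... | false = refl
  ... | true  = contradiction
    (≤ᵇ⇒≤ _ _ (subst T (criterion≡ i) (tabulate⁻ (all⁺ criterion _ (Equivalence.from T-≡ eq)) i))) bad

  isParking≡isFull : isParking f ≡ isFull (parkFrom (holes n) 0 f)
  isParking≡isFull with isFull F in full
  ... | true  = isParking-true λ i → begin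
        suc (toℕ i)                           ≡⟨ isFull⇒occupiedUpTo F full (subst (toℕ i <_) (sym length-F) (toℕ<n i)) ⟨
        occupiedUpTo (toℕ i) F                ≤⟨ parkFrom-occupiedUpTo f 0 (holes n) (toℕ i) ⟩
        prefsUpTo (toℕ i) f + occupiedUpTo (toℕ i) (holes n) ≡⟨ cong (prefsUpTo (toℕ i) f +_) (occupiedUpTo-holes n (toℕ i)) ⟩
        prefsUpTo (toℕ i) f + 0               ≡⟨ +-identityʳ _ ⟩
        prefsUpTo (toℕ i) f                   ∎
    where open ≤-Reasoning
  ... | false with ¬isFull⇒vacant F full
  ... | i , i<l , v = isParking-false (fromℕ< i<n) (<⇒≱ (begin-strict
        prefsUpTo (toℕ (fromℕ< i<n)) f ≡⟨ cong (λ j → prefsUpTo j f) (toℕ-fromℕ< i<n) ⟩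
        prefsUpTo i f                  ≡⟨ +-identityʳ _ ⟨
        prefsUpTo i f + 0              ≡⟨ cong (prefsUpTo i f +_) (occupiedUpTo-holes n i) ⟨
        prefsUpTo i f + occupiedUpTo i (holes n) ≡⟨ proj₂ (parkFrom-vacant f 0 (holes n) i v) ⟨
        occupiedUpTo i F               ≤⟨ vacant⇒occupiedUpTo F i v ⟩
        i                              <⟨ n<1+n i ⟩
        suc i                          ≡⟨ cong suc (toℕ-fromℕ< i<n) ⟨
        suc (toℕ (fromℕ< i<n))         ∎))
    where
    open ≤-Reasoning
    i<n : i < n
    i<n = subst (i <_) length-F i<l


-- Patterns of length three

∈-subseqs⁺ : ∀ {s π : List ℕ} → s ⊆ π → s ∈ subseqs π
∈-subseqs⁺ []                      = here refl
∈-subseqs⁺ (x ∷ʳ s⊆π)              = ∈-++⁺ʳ _ (∈-subseqs⁺ s⊆π)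
∈-subseqs⁺ (_∷_ {x = x} refl s⊆π) = ∈-++⁺ˡ (∈-map⁺ (x ∷_) (∈-subseqs⁺ s⊆π))

∈-subseqs⁻ : ∀ {s} (π : List ℕ) → s ∈ subseqs π → s ⊆ π
∈-subseqs⁻ []      (here refl) = []
∈-subseqs⁻ (x ∷ π) s∈ with ∈-++⁻ (map (x ∷_) (subseqs π)) s∈
... | inj₁ s∈map with ∈-map⁻ (x ∷_) s∈map
...   | t , t∈ , refl = refl ∷ ∈-subseqs⁻ π t∈
∈-subseqs⁻ (x ∷ π) s∈ | inj₂ s∈rest = x ∷ʳ ∈-subseqs⁻ π s∈rest

contains-sublist : ∀ {s} π σ → s ⊆ π → T (orderIso s σ) → T (contains π σ)
contains-sublist π σ s⊆π iso = any⁺ (λ s → orderIso s σ) (lose (∈-subseqs⁺ s⊆π) iso)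

contains⇒sublist : ∀ π σ → T (contains π σ) → ∃ λ s → s ⊆ π × T (orderIso s σ)
contains⇒sublist π σ c with find (any⁻ (λ s → orderIso s σ) (subseqs π) c)
... | s , s∈ , iso = s , ∈-subseqs⁻ π s∈ , iso

orderIso-sound : ∀ xs σ → T (orderIso xs σ) → ∀ {a b} → a < length xs → b < length xs →
                 (lookupL xs a <ᵇ lookupL xs b) ≡ (lookupL σ a <ᵇ lookupL σ b)
orderIso-sound xs σ iso {a} {b} a<l b<l =
  toWitness (applyUpTo⁻ id l (all⁺ (agrees a) (upTo l) (applyUpTo⁻ id l (all⁺ row (upTo l) rows) a<l)) b<l)
  where
  l = length xs
  agrees : ℕ → ℕ → Bool
  agrees a b = ⌊ (lookupL xs a <ᵇ lookupL xs b) ≟ᵇ (lookupL σ a <ᵇ lookupL σ b) ⌋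
  row : ℕ → Bool
  row a = all (agrees a) (upTo l)
  rows : T (all row (upTo l))
  rows = proj₂ (Equivalence.to T-∧ iso)

orderIso⇒length : ∀ xs σ → T (orderIso xs σ) → length xs ≡ length σ
orderIso⇒length xs σ iso = toWitness {a? = length xs ≟ length σ} (proj₁ (Equivalence.to T-∧ iso))

private
  <ᵇ-true : ∀ {m n} → m < n → (m <ᵇ n) ≡ true
  <ᵇ-true m<n = Equivalence.to T-≡ (<⇒<ᵇ m<n)

  <ᵇ-false : ∀ {m n} → n ≤ m → (m <ᵇ n) ≡ false
  <ᵇ-false {m} {n} n≤m with m <ᵇ n in eq
  ... | false = refl
  ... | true  = contradiction n≤m (<⇒≱ (<ᵇ⇒< m n (Equivalence.from T-≡ eq)))

  <ᵇ-sound : ∀ {m n} → (m <ᵇ n) ≡ true → m < n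
  <ᵇ-sound {m} {n} eq = <ᵇ⇒< m n (Equivalence.from T-≡ eq)

Is132 Is231 Is312 : ℕ → ℕ → ℕ → Set
Is132 x y z = x < z × z < y
Is231 x y z = z < x × x < y
Is312 x y z = y < z × z < x

module _ {x y z : ℕ} where

  private
    xyz : List ℕ
    xyz = x ∷ y ∷ z ∷ []
    cmp : ∀ σ → T (orderIso xyz σ) → ∀ a b → a < 3 → b < 3 →
          (lookupL xyz a <ᵇ lookupL xyz b) ≡ (lookupL σ a <ᵇ lookupL σ b)
    cmp σ iso a b = orderIso-sound xyz σ iso

  orderIso⇒Is132 : T (orderIso xyz p132) → Is132 x y z
  orderIso⇒Is132 iso = <ᵇ-sound (cmp p132 iso 0 2 z<s (s<s (s<s z<s))) , <ᵇ-sound (cmp p132 iso 2 1 (s<s (s<s z<s)) (s<s z<s))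

  orderIso⇒Is231 : T (orderIso xyz p231) → Is231 x y z
  orderIso⇒Is231 iso = <ᵇ-sound (cmp p231 iso 2 0 (s<s (s<s z<s)) z<s) , <ᵇ-sound (cmp p231 iso 0 1 z<s (s<s z<s))

  orderIso⇒Is312 : T (orderIso xyz p312) → Is312 x y z
  orderIso⇒Is312 iso = <ᵇ-sound (cmp p312 iso 1 2 (s<s z<s) (s<s (s<s z<s))) , <ᵇ-sound (cmp p312 iso 2 0 (s<s (s<s z<s)) z<s)

  Is132⇒orderIso : Is132 x y z → T (orderIso xyz p132)
  Is132⇒orderIso (x<z , z<y)
    rewrite <ᵇ-false {x} ≤-refl | <ᵇ-false {y} ≤-refl | <ᵇ-false {z} ≤-refl
          | <ᵇ-true (<-trans x<z z<y) | <ᵇ-true x<z | <ᵇ-true z<y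
          | <ᵇ-false (<⇒≤ (<-trans x<z z<y)) | <ᵇ-false (<⇒≤ x<z) | <ᵇ-false (<⇒≤ z<y) = _

  Is231⇒orderIso : Is231 x y z → T (orderIso xyz p231)
  Is231⇒orderIso (z<x , x<y)
    rewrite <ᵇ-false {x} ≤-refl | <ᵇ-false {y} ≤-refl | <ᵇ-false {z} ≤-refl
          | <ᵇ-true (<-trans z<x x<y) | <ᵇ-true z<x | <ᵇ-true x<y
          | <ᵇ-false (<⇒≤ (<-trans z<x x<y)) | <ᵇ-false (<⇒≤ z<x) | <ᵇ-false (<⇒≤ x<y) = _

  Is312⇒orderIso : Is312 x y z → T (orderIso xyz p312)
  Is312⇒orderIso (y<z , z<x)
    rewrite <ᵇ-false {x} ≤-refl | <ᵇ-false {y} ≤-refl | <ᵇ-false {z} ≤-refl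
          | <ᵇ-true (<-trans y<z z<x) | <ᵇ-true y<z | <ᵇ-true z<x
          | <ᵇ-false (<⇒≤ (<-trans y<z z<x)) | <ᵇ-false (<⇒≤ y<z) | <ᵇ-false (<⇒≤ z<x) = _

Avoids : (ℕ → ℕ → ℕ → Set) → List ℕ → Set
Avoids P w = ∀ {x y z} → x ∷ y ∷ z ∷ [] ⊆ w → ¬ P x y z

private
  length≡3 : ∀ (s : List ℕ) → length s ≡ 3 → ∃ λ x → ∃ λ y → ∃ λ z → s ≡ x ∷ y ∷ z ∷ []
  length≡3 (x ∷ y ∷ z ∷ []) refl = x , y , z , refl

avoids-true : ∀ {P : ℕ → ℕ → ℕ → Set} σ → length σ ≡ 3 →
  (∀ {x y z} → T (orderIso (x ∷ y ∷ z ∷ []) σ) → P x y z) → ∀ {w} → Avoids P w → avoids w σ ≡ true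
avoids-true σ l≡3 sound {w} av with contains w σ in eq
... | false = refl
... | true with contains⇒sublist w σ (Equivalence.from T-≡ eq)
...   | s , s⊆w , iso with length≡3 s (trans (orderIso⇒length s σ iso) l≡3)
...     | _ , _ , _ , refl = contradiction (sound iso) (av s⊆w)

avoids-false : ∀ {x y z w} σ → x ∷ y ∷ z ∷ [] ⊆ w → T (orderIso (x ∷ y ∷ z ∷ []) σ) → avoids w σ ≡ false
avoids-false {w = w} σ s⊆w iso = cong not (Equivalence.to T-≡ (contains-sublist w σ s⊆w iso))

all-false : ∀ {A : Set} {p : A → Bool} {xs} → Any (λ x → p x ≡ false) xs → all p xs ≡ false
all-false {p = p} {xs = _ ∷ xs} (here px) = cong (_∧ all p xs) px
all-false {p = p} (there {x = x} pxs) = trans (cong (p x ∧_) (all-false pxs)) (∧-zeroʳ (p x))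

⊆-++-split : ∀ {s : List ℕ} A B → s ⊆ A ++ B →
             ∃ λ s₁ → ∃ λ s₂ → s ≡ s₁ ++ s₂ × s₁ ⊆ A × s₂ ⊆ B
⊆-++-split []      B s⊆B = [] , _ , refl , [] , s⊆B
⊆-++-split (a ∷ A) B (.a ∷ʳ s⊆) with ⊆-++-split A B s⊆
... | s₁ , s₂ , refl , s₁⊆A , s₂⊆B = s₁ , s₂ , refl , a ∷ʳ s₁⊆A , s₂⊆B
⊆-++-split (a ∷ A) B (refl ∷ s⊆) with ⊆-++-split A B s⊆
... | s₁ , s₂ , refl , s₁⊆A , s₂⊆B = a ∷ s₁ , s₂ , refl , refl ∷ s₁⊆A , s₂⊆B

module _ (P : ℕ → ℕ → ℕ → Set) (U V : List ℕ) (c : ℕ) where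

  avoids-insert : Avoids P (U ++ V) →
    (∀ {y z} → y ∷ z ∷ [] ⊆ V → ¬ P c y z) →
    (∀ {x z} → x ∈ U → z ∈ V → ¬ P x c z) →
    (∀ {x y} → x ∷ y ∷ [] ⊆ U → ¬ P x y c) →
    Avoids P (U ++ c ∷ V)
  avoids-insert av first middle last s⊆ with ⊆-++-split U (c ∷ V) s⊆
  ... | s₁ , s₂ , eq , s₁⊆U , .c ∷ʳ s₂⊆V = av (subst (_⊆ U ++ V) (sym eq) (++⁺ s₁⊆U s₂⊆V))
  avoids-insert av first middle last s⊆ | []            , _ ∷ _ , refl , _ , refl ∷ yz⊆V = first yz⊆V
  avoids-insert av first middle last s⊆ | _ ∷ []        , _ ∷ _ , refl , x⊆U , refl ∷ z⊆V = middle (to∈ x⊆U) (to∈ z⊆V)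
  avoids-insert av first middle last s⊆ | _ ∷ _ ∷ []    , _ ∷ _ , refl , xy⊆U , refl ∷ _ = last xy⊆U
  avoids-insert av first middle last s⊆ | _ ∷ _ ∷ _ ∷ []    , _ ∷ _ , () , _ , refl ∷ _
  avoids-insert av first middle last s⊆ | _ ∷ _ ∷ _ ∷ _ ∷ _ , _ ∷ _ , () , _ , refl ∷ _

Descending : List ℕ → Set
Descending V = ∀ {y z} → y ∷ z ∷ [] ⊆ V → z < y

Descending-∷ : ∀ {c V} → All (_< c) V → Descending V → Descending (c ∷ V)
Descending-∷ below desc (refl ∷ z⊆V) = All.lookup below (to∈ z⊆V)
Descending-∷ below desc (_ ∷ʳ yz⊆V)  = desc yz⊆V

_≪_ : List ℕ → List ℕ → Set
U ≪ V = ∀ {x z} → x ∈ U → z ∈ V → x < z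

All-<-insert : ∀ {c} U V → All (_< c) (U ++ V) → All (_< suc c) (U ++ c ∷ V)
All-<-insert {c} U V below =
  All.++⁺ (All.map m<n⇒m<1+n (All.++⁻ˡ U below)) (n<1+n c ∷ All.map m<n⇒m<1+n (All.++⁻ʳ U below))

all-avoids-pair : ∀ w σ τ → avoids w σ ≡ true → avoids w τ ≡ true → all (avoids w) (σ ∷ τ ∷ []) ≡ true
all-avoids-pair w σ τ = cong₂ (λ x y → x ∧ (y ∧ true))


-- Parking a car in a lot of a given shape

length-holes : ∀ a R → length (holes a ++ R) ≡ a + length R
length-holes zero    R = refl
length-holes (suc a) R = cong suc (length-holes a R)

holes-suc : ∀ a R → holes (suc a) ++ R ≡ holes a ++ nothing ∷ R
holes-suc zero    R = refl
holes-suc (suc a) R = cong (nothing ∷_) (holes-suc a R)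

parked-++ : ∀ A B → parked (A ++ B) ≡ parked A ++ parked B
parked-++ []            B = refl
parked-++ (just x ∷ A)  B = cong (x ∷_) (parked-++ A B)
parked-++ (nothing ∷ A) B = parked-++ A B

parked-holes : ∀ a R → parked (holes a ++ R) ≡ parked R
parked-holes zero    R = refl
parked-holes (suc a) R = parked-holes a R

parked-cars : ∀ W R → parked (cars W ++ R) ≡ W ++ parked R
parked-cars []      R = refl
parked-cars (w ∷ W) R = cong (w ∷_) (parked-cars W R)

∈-parked-cars : ∀ {x W} → x ∈ W → x ∈ parked (cars W)
∈-parked-cars (here refl) = here refl
∈-parked-cars (there x∈W) = there (∈-parked-cars x∈W)

∈-parked-++ˡ : ∀ {x} A B → x ∈ parked A → x ∈ parked (A ++ B)
∈-parked-++ˡ A B x∈A = subst (_ ∈_) (sym (parked-++ A B)) (∈-++⁺ˡ x∈A)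

∈-parked-++ʳ : ∀ {x} A B → x ∈ parked B → x ∈ parked (A ++ B)
∈-parked-++ʳ A B x∈B = subst (_ ∈_) (sym (parked-++ A B)) (∈-++⁺ʳ (parked A) x∈B)

countHoles-holes : ∀ a R → countHoles (holes a ++ R) ≡ a + countHoles R
countHoles-holes zero    R = refl
countHoles-holes (suc a) R = cong suc (countHoles-holes a R)

countHoles-cars : ∀ W R → countHoles (cars W ++ R) ≡ countHoles R
countHoles-cars []      R = refl
countHoles-cars (w ∷ W) R = countHoles-cars W R

cars-∷ʳ : ∀ W c R → cars W ++ just c ∷ R ≡ cars (W ++ c ∷ []) ++ R
cars-∷ʳ W c R = sym (trans (cong (_++ R) (map-++ just W (c ∷ []))) (++-assoc (cars W) (just c ∷ []) R))

cars-++ : ∀ U V R → cars U ++ cars V ++ R ≡ cars (U ++ V) ++ R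
cars-++ U V R = sym (trans (cong (_++ R) (map-++ just U V)) (++-assoc (cars U) (cars V) R))

parkCar-skip : ∀ P {a} → length P ≡ a → ∀ p c R → parkCar (a + p) c (P ++ R) ≡ P ++ parkCar p c R
parkCar-skip []      refl p c R = refl
parkCar-skip (s ∷ P) refl p c R = cong (s ∷_) (parkCar-skip P refl p c R)

parkCar-skipHoles : ∀ a p c R → parkCar (a + p) c (holes a ++ R) ≡ holes a ++ parkCar p c R
parkCar-skipHoles a = parkCar-skip (holes a) (length-replicate a)

parkCar-skipCars : ∀ W {m} → length W ≡ m → ∀ p c R → parkCar (m + p) c (cars W ++ R) ≡ cars W ++ parkCar p c R
parkCar-skipCars W eq = parkCar-skip (cars W) (trans (length-map just W) eq)

parkCar-holes : ∀ p d c R → parkCar p c (holes (p + suc d) ++ R) ≡ holes p ++ just c ∷ holes d ++ R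
parkCar-holes zero    d c R = refl
parkCar-holes (suc p) d c R = cong (nothing ∷_) (parkCar-holes p d c R)

parkCar-holesOnly : ∀ p d c → parkCar p c (holes (p + suc d)) ≡ holes p ++ just c ∷ holes d
parkCar-holesOnly zero    d c = refl
parkCar-holesOnly (suc p) d c = cong (nothing ∷_) (parkCar-holesOnly p d c)

parkCar-cars : ∀ W {p} → p ≤ length W → ∀ c R → parkCar p c (cars W ++ R) ≡ cars W ++ parkCar 0 c R
parkCar-cars []      z≤n       c R = refl
parkCar-cars (w ∷ W) z≤n       c R = cong (just w ∷_) (parkCar-cars W z≤n c R)
parkCar-cars (w ∷ W) (s≤s p≤l) c R = cong (just w ∷_) (parkCar-cars W p≤l c R)

parkCar-afterCars : ∀ W {p} → p ≤ length W → ∀ c R → parkCar p c (cars W ++ nothing ∷ R) ≡ cars (W ++ c ∷ []) ++ R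
parkCar-afterCars W p≤l c R = trans (parkCar-cars W p≤l c (nothing ∷ R)) (cars-∷ʳ W c R)

parkCar-intoGap : ∀ W {g p} → p < length W + suc g → ∀ c R →
  ∃ λ i → ∃ λ j →
    parkCar p c (cars W ++ holes (suc (suc g)) ++ R) ≡ cars W ++ holes i ++ just c ∷ nothing ∷ holes j ++ R
parkCar-intoGap [] {g} {p} p<1+g c R with m≤n⇒∃[o]m+o≡n (≤-pred p<1+g)
... | j , refl = p , j , trans (cong (λ l → parkCar p c (holes l ++ R)) (sym (trans (+-suc p (suc j)) (cong suc (+-suc p j)))))
                               (parkCar-holes p (suc j) c R)
parkCar-intoGap (w ∷ W) {g} {zero}  p<       c R
  with parkCar-intoGap W {g} {zero} (≤-trans (s≤s z≤n) (m≤n+m (suc g) (length W))) c R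
... | i , j , eq = i , j , cong (just w ∷_) eq
parkCar-intoGap (w ∷ W) {p = suc p} (s<s p<) c R with parkCar-intoGap W p< c R
... | i , j , eq = i , j , cong (just w ∷_) eq

∈-parked-parkCar-holes : ∀ {i r} → i < r → ∀ c → c ∈ parked (parkCar i c (holes r))
∈-parked-parkCar-holes {zero}  {suc r} _         c = here refl
∈-parked-parkCar-holes {suc i} {suc r} (s<s i<r) c = ∈-parked-parkCar-holes i<r c

parkCar-pastCars : ∀ W {i r} → i < length W + suc r → ∀ c →
  ∃ λ S → parkCar i c (cars W ++ holes (suc r)) ≡ cars W ++ S × c ∈ parked S
parkCar-pastCars []      i<1+r       c = _ , refl , ∈-parked-parkCar-holes i<1+r c
parkCar-pastCars (w ∷ W) {zero} {r} i<  c with parkCar-pastCars W {zero} {r} (≤-trans (s≤s z≤n) (m≤n+m (suc r) (length W))) c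
... | S , eq , c∈S = S , cong (just w ∷_) eq , c∈S
parkCar-pastCars (w ∷ W) {suc i} (s<s i<) c with parkCar-pastCars W i< c
... | S , eq , c∈S = S , cong (just w ∷_) eq , c∈S

parkCar-stuckOrParked : ∀ p c R → parkCar p c R ≡ R ⊎ c ∈ parked (parkCar p c R)
parkCar-stuckOrParked p       c []            = inj₁ refl
parkCar-stuckOrParked zero    c (nothing ∷ R) = inj₂ (here refl)
parkCar-stuckOrParked zero    c (just d ∷ R)  with parkCar-stuckOrParked zero c R
... | inj₁ eq  = inj₁ (cong (just d ∷_) eq)
... | inj₂ c∈ = inj₂ (there c∈)
parkCar-stuckOrParked (suc p) c (just d ∷ R)  with parkCar-stuckOrParked p c R
... | inj₁ eq  = inj₁ (cong (just d ∷_) eq)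
... | inj₂ c∈ = inj₂ (there c∈)
parkCar-stuckOrParked (suc p) c (nothing ∷ R) with parkCar-stuckOrParked p c R
... | inj₁ eq  = inj₁ (cong (nothing ∷_) eq)
... | inj₂ c∈ = inj₂ c∈

parkCar-pastCar : ∀ p c x R → parkCar p c (just x ∷ R) ≡ just x ∷ parkCar (pred p) c R
parkCar-pastCar zero    c x R = refl
parkCar-pastCar (suc p) c x R = refl


-- Counting completions

data Extends (c : ℕ) : Lot → Lot → Set where
  []     : Extends c [] []
  keep   : ∀ {s L M} → Extends c L M → Extends c (s ∷ L) (s ∷ M)
  fill   : ∀ {y L M} → c ≤ y → Extends c L M → Extends c (nothing ∷ L) (just y ∷ M)

Extends-refl : ∀ {c} L → Extends c L L
Extends-refl []      = []
Extends-refl (s ∷ L) = keep (Extends-refl L)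

Extends-trans : ∀ {c L M N} → Extends c L M → Extends (suc c) M N → Extends c L N
Extends-trans []            []            = []
Extends-trans (keep L⊑M)    (keep M⊑N)    = keep (Extends-trans L⊑M M⊑N)
Extends-trans (keep L⊑M)    (fill c<y M⊑N) = fill (<⇒≤ c<y) (Extends-trans L⊑M M⊑N)
Extends-trans (fill c≤y L⊑M) (keep M⊑N)   = fill c≤y (Extends-trans L⊑M M⊑N)

Extends-parkCar : ∀ p c L → Extends c L (parkCar p c L)
Extends-parkCar p       c []            = []
Extends-parkCar zero    c (nothing ∷ L) = fill ≤-refl (Extends-refl L)
Extends-parkCar zero    c (just d ∷ L)  = keep (Extends-parkCar zero c L)
Extends-parkCar (suc p) c (s ∷ L)       = keep (Extends-parkCar p c L)

Extends-parkFrom : ∀ {n k} (ps : Vec (Fin n) k) c L → Extends c L (parkFrom L c ps)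
Extends-parkFrom []       c L = Extends-refl L
Extends-parkFrom (p ∷ ps) c L = Extends-trans (Extends-parkCar (toℕ p) c L) (Extends-parkFrom ps (suc c) _)

Extends-++ : ∀ {c} P {S M} → Extends c (P ++ S) M →
  ∃ λ P′ → ∃ λ S′ → M ≡ P′ ++ S′ × Extends c P P′ × Extends c S S′
Extends-++ []      S⊑ = [] , _ , refl , [] , S⊑
Extends-++ (s ∷ P) (keep ext) with Extends-++ P ext
... | P′ , S′ , refl , P⊑ , S⊑ = s ∷ P′ , S′ , refl , keep P⊑ , S⊑
Extends-++ (nothing ∷ P) (fill c≤y ext) with Extends-++ P ext
... | P′ , S′ , refl , P⊑ , S⊑ = _ , S′ , refl , fill c≤y P⊑ , S⊑

Extends⇒⊆ : ∀ {c L M} → Extends c L M → parked L ⊆ lotPerm M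
Extends⇒⊆ []                      = []
Extends⇒⊆ (keep {just x} L⊑M)     = refl ∷ Extends⇒⊆ L⊑M
Extends⇒⊆ (keep {nothing} L⊑M)    = _ ∷ʳ Extends⇒⊆ L⊑M
Extends⇒⊆ (fill c≤y L⊑M)          = _ ∷ʳ Extends⇒⊆ L⊑M

countParked-parkCar : ∀ p c L → countParked (parkCar p c L) ≤ suc (countParked L)
countParked-parkCar p       c []            = z≤n
countParked-parkCar zero    c (nothing ∷ L) = ≤-refl
countParked-parkCar zero    c (just d ∷ L)  = s≤s (countParked-parkCar zero c L)
countParked-parkCar (suc p) c (just d ∷ L)  = s≤s (countParked-parkCar p c L)
countParked-parkCar (suc p) c (nothing ∷ L) = countParked-parkCar p c L

countParked-parkFrom : ∀ {n k} (ps : Vec (Fin n) k) c L → countParked (parkFrom L c ps) ≤ countParked L + k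
countParked-parkFrom [] c L = ≤-reflexive (sym (+-identityʳ _))
countParked-parkFrom {k = suc k} (p ∷ ps) c L = begin
  countParked (parkFrom (parkCar (toℕ p) c L) (suc c) ps) ≤⟨ countParked-parkFrom ps (suc c) _ ⟩
  countParked (parkCar (toℕ p) c L) + k                  ≤⟨ +-monoˡ-≤ k (countParked-parkCar (toℕ p) c L) ⟩
  suc (countParked L) + k                                ≡⟨ +-suc _ k ⟨
  countParked L + suc k                                  ∎
  where open ≤-Reasoning

isFull⇒countParked : ∀ L → isFull L ≡ true → countParked L ≡ length L
isFull⇒countParked []            _    = refl
isFull⇒countParked (just x ∷ L)  full = cong suc (isFull⇒countParked L full)

isFull-hole : ∀ P S → isFull (P ++ nothing ∷ S) ≡ false
isFull-hole []            S = refl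
isFull-hole (just x ∷ P)  S = isFull-hole P S
isFull-hole (nothing ∷ P) S = refl

Matches : List (List ℕ) → ℕ → ℕ → ℕ → Set
Matches σs x y z = Any (λ σ → T (orderIso (x ∷ y ∷ z ∷ []) σ)) σs

module Completions (n : ℕ) (σs : List (List ℕ)) where

  good : Lot → Bool
  good L = isFull L ∧ all (avoids (lotPerm L)) σs

  completions : Lot → ℕ → ℕ → ℕ
  completions L c k = countB (λ ps → good (parkFrom L c ps)) (allVecs n k)

  pk≡completions : pk n σs ≡ completions (holes n) 0 n
  pk≡completions = countB-cong (λ f → cong₂ _∧_ (isParking≡isFull f)
    (cong (λ L → all (avoids (lotPerm L)) σs) (parkAll≡parkFrom f))) (allVecs n n)

  completions-zero : ∀ L c → good L ≡ true → completions L c 0 ≡ 1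
  completions-zero L c g rewrite g = refl

  completions-suc : ∀ L c k → completions L c (suc k) ≡ sumBelow n (λ p → completions (parkCar p c L) (suc c) k)
  completions-suc L c k = countB-concatMap-allFin _ n (λ p → map (p ∷_) (allVecs n k)) _
    (λ p → countB-map _ (p ∷_) (allVecs n k))

  Dead : Lot → ℕ → Set
  Dead L c = ∀ M → Extends c L M → good M ≡ false

  completions-dead : ∀ {L c} k → Dead L c → completions L c k ≡ 0
  completions-dead {L} {c} k dead = countB-zero _ (λ ps → dead _ (Extends-parkFrom ps c L)) (allVecs n k)

  dead-tooFewCars : ∀ L c k → k < countHoles L → completions L c k ≡ 0
  dead-tooFewCars L c k k<holes = countB-zero _ notGood (allVecs n k)
    where
    notGood : ∀ (ps : Vec (Fin n) k) → good (parkFrom L c ps) ≡ false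
    notGood ps with isFull (parkFrom L c ps) in full
    ... | false = refl
    ... | true  = contradiction (+-cancelˡ-≤ (countParked L) _ _ (begin
          countParked L + countHoles L      ≡⟨ length≡countParked+countHoles L ⟨
          length L                          ≡⟨ length-parkFrom ps c L ⟨
          length (parkFrom L c ps)          ≡⟨ isFull⇒countParked (parkFrom L c ps) full ⟨
          countParked (parkFrom L c ps)     ≤⟨ countParked-parkFrom ps c L ⟩
          countParked L + k                 ∎)) (<⇒≱ k<holes)
      where open ≤-Reasoning

  good-hole : ∀ P S → good (P ++ nothing ∷ S) ≡ false
  good-hole P S = cong (_∧ all (avoids (lotPerm (P ++ nothing ∷ S))) σs) (isFull-hole P S)

  triple-dead : ∀ {M x y z} → x ∷ y ∷ z ∷ [] ⊆ lotPerm M → Matches σs x y z → good M ≡ false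
  triple-dead {M} xyz⊆ hit =
    trans (cong (isFull M ∧_) (all-false (Any.map (λ {σ} → avoids-false σ xyz⊆) hit))) (∧-zeroʳ (isFull M))

  dead-holeBetween : ∀ {c} P S {x z} → x ∈ parked P → z ∈ parked S →
    (∀ {y} → c ≤ y → Matches σs x y z) → Dead (P ++ nothing ∷ S) c
  dead-holeBetween P S x∈ z∈ hit M ext with Extends-++ P ext
  ... | P′ , nothing ∷ S′ , refl , _ , keep _ = good-hole P′ S′
  ... | P′ , just y ∷ S′ , refl , P⊑ , fill c≤y S⊑ = triple-dead
    (subst (_ ⊆_) (sym (map-++ (fromMaybe 0) P′ (just y ∷ S′)))
      (++⁺ (⊆-trans (from∈ x∈) (Extends⇒⊆ P⊑)) (refl ∷ ⊆-trans (from∈ z∈) (Extends⇒⊆ S⊑))))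
    (hit c≤y)

  dead-holeBefore : ∀ {c} P S {y z} → y ∷ z ∷ [] ⊆ parked S →
    (∀ {x} → c ≤ x → Matches σs x y z) → Dead (P ++ nothing ∷ S) c
  dead-holeBefore P S yz⊆ hit M ext with Extends-++ P ext
  ... | P′ , nothing ∷ S′ , refl , _ , keep _ = good-hole P′ S′
  ... | P′ , just x ∷ S′ , refl , P⊑ , fill c≤x S⊑ = triple-dead
    (subst (_ ⊆_) (sym (map-++ (fromMaybe 0) P′ (just x ∷ S′)))
      (++⁺ˡ (lotPerm P′) (refl ∷ ⊆-trans yz⊆ (Extends⇒⊆ S⊑))))
    (hit c≤x)

  good-cars : ∀ W → all (avoids W) σs ≡ true → good (cars W) ≡ true
  good-cars W av = cong₂ _∧_ (isFull-cars W) (trans (cong (λ π → all (avoids π) σs) (lotPerm-cars W)) av)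
    where
    isFull-cars : ∀ W → isFull (cars W) ≡ true
    isFull-cars []      = refl
    isFull-cars (w ∷ W) = isFull-cars W
    lotPerm-cars : ∀ W → lotPerm (cars W) ≡ W
    lotPerm-cars []      = refl
    lotPerm-cars (w ∷ W) = cong (w ∷_) (lotPerm-cars W)


-- Avoiding 132 and 231

mutual
  vCount : ℕ → ℕ → ℕ → ℕ
  vCount a m r = vLeft a m r + vRight a m r + vDone a r

  vLeft : ℕ → ℕ → ℕ → ℕ
  vLeft zero    m r = 0
  vLeft (suc a) m r = vCount a (suc m) r

  vRight : ℕ → ℕ → ℕ → ℕ
  vRight a m zero    = 0
  vRight a m (suc r) = suc m * vCount a (suc m) r

  vDone : ℕ → ℕ → ℕ
  vDone zero    zero    = 1
  vDone zero    (suc r) = 0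
  vDone (suc a) r       = 0

sum-vCount : ∀ k m → sumAntidiagonal k (λ a r → vCount a m r) ≡ (2 + m) ↑ k
sum-vCount zero    m = refl
sum-vCount (suc k) m = begin
  sumAntidiagonal (suc k) (λ a r → vLeft a m r + vRight a m r + vDone a r)
    ≡⟨ sumAntidiagonal-+ (suc k) (λ a r → vLeft a m r + vRight a m r) vDone ⟩
  sumAntidiagonal (suc k) (λ a r → vLeft a m r + vRight a m r) + sumAntidiagonal (suc k) vDone
    ≡⟨ cong₂ _+_ (sumAntidiagonal-+ (suc k) (λ a r → vLeft a m r) (λ a r → vRight a m r)) (sumAntidiagonal-zero k) ⟩
  sumAntidiagonal (suc k) (λ a r → vLeft a m r) + sumAntidiagonal (suc k) (λ a r → vRight a m r) + 0
    ≡⟨ +-identityʳ _ ⟩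
  sumAntidiagonal k (λ a r → vCount a (suc m) r) + sumAntidiagonal (suc k) (λ a r → vRight a m r)
    ≡⟨ cong₂ _+_ (sum-vCount k (suc m)) (sumAntidiagonal-suc k (λ a r → vRight a m r)) ⟩
  (3 + m) ↑ k + (sumAntidiagonal k (λ a r → suc m * vCount a (suc m) r) + 0)
    ≡⟨ cong ((3 + m) ↑ k +_) (trans (+-identityʳ _) (sumAntidiagonal-*ˡ k (suc m) _)) ⟩
  (3 + m) ↑ k + suc m * sumAntidiagonal k (λ a r → vCount a (suc m) r)
    ≡⟨ cong (λ x → (3 + m) ↑ k + suc m * x) (sum-vCount k (suc m)) ⟩
  (2 + m) ↑ suc k ∎
  where open ≡-Reasoning

AvoidsV : List ℕ → Set
AvoidsV W = Avoids Is132 W × Avoids Is231 W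

record VBlock (m : ℕ) (W : List ℕ) : Set where
  field
    length≡ : length W ≡ m
    below   : All (_< m) W
    0∈      : 0 ∈ W
    avoidsV : AvoidsV W

  0<m : 0 < m
  0<m = All.lookup below 0∈

VBlock-start : VBlock 1 (0 ∷ [])
VBlock-start = record
  { length≡ = refl ; below = z<s ∷ [] ; 0∈ = here refl
  ; avoidsV = (λ { (_ ∷ʳ ()) ; (_ ∷ ()) }) , (λ { (_ ∷ʳ ()) ; (_ ∷ ()) }) }

module _ {m W} (B : VBlock m W) where
  open VBlock B

  VBlock-prepend : VBlock (suc m) (m ∷ W)
  VBlock-prepend = record
    { length≡ = cong suc length≡
    ; below   = n<1+n m ∷ All.map m<n⇒m<1+n below
    ; 0∈      = there 0∈
    ; avoidsV = avoids-insert Is132 [] W m (proj₁ avoidsV)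
                  (λ yz⊆W (m<z , z<y) → <-asym (<-trans m<z z<y) (All.lookup below (to∈ yz⊆W))) (λ ()) (λ ())
              , avoids-insert Is231 [] W m (proj₂ avoidsV)
                  (λ yz⊆W (_ , m<y) → <-asym m<y (All.lookup below (to∈ yz⊆W))) (λ ()) (λ ())
    }

  VBlock-append : VBlock (suc m) (W ++ m ∷ [])
  VBlock-append = record
    { length≡ = trans (length-++ W) (trans (+-comm (length W) 1) (cong suc length≡))
    ; below   = All.++⁺ (All.map m<n⇒m<1+n below) (n<1+n m ∷ [])
    ; 0∈      = ∈-++⁺ˡ 0∈
    ; avoidsV = avoids-insert Is132 W [] m (subst (Avoids Is132) (sym (++-identityʳ W)) (proj₁ avoidsV))
                  (λ ()) (λ _ ()) (λ xy⊆W (_ , m<y) → <-asym m<y (All.lookup below (to∈ (∷ˡ⁻ xy⊆W))))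
              , avoids-insert Is231 W [] m (subst (Avoids Is231) (sym (++-identityʳ W)) (proj₂ avoidsV))
                  (λ ()) (λ _ ()) (λ xy⊆W (m<x , _) → <-asym m<x (All.lookup below (to∈ xy⊆W)))
    }

module CompletionsV (n : ℕ) where
  open Completions n (p132 ∷ p231 ∷ [])

  private
    good-V : ∀ {m W} → VBlock m W → good (cars W ++ []) ≡ true
    good-V {W = W} B rewrite ++-identityʳ (cars W) = good-cars W (all-avoids-pair W p132 p231
      (avoids-true p132 refl orderIso⇒Is132 (proj₁ (VBlock.avoidsV B)))
      (avoids-true p231 refl orderIso⇒Is231 (proj₂ (VBlock.avoidsV B))))

  mutual
    completionsV : ∀ a r {m W} → VBlock m W → a + (m + r) ≡ n →
                   completions (holes a ++ cars W ++ holes r) m (a + r) ≡ vCount a m r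
    completionsV zero    zero    {m} {W} B _ = completions-zero (cars W ++ []) m (good-V B)
    completionsV zero    (suc r) {m} {W} B size = begin
      completions L m (suc r)       ≡⟨ completions-suc L m r ⟩
      sumBelow n h                  ≡⟨ cong (λ t → sumBelow t h) size ⟨
      sumBelow (m + suc r) h        ≡⟨ rightwards 0 (suc r) B size refl ⟩
      vRight 0 m (suc r)            ≡⟨ +-identityʳ _ ⟨
      vCount 0 m (suc r)            ∎
      where
      open ≡-Reasoning
      L = cars W ++ holes (suc r)
      h = λ p → completions (parkCar p m L) (suc m) r
    completionsV (suc a) r {m} {W} B size = begin
      completions L m (suc (a + r))                                ≡⟨ completions-suc L m (a + r) ⟩
      sumBelow n h                                                 ≡⟨ cong (λ t → sumBelow t h) size ⟨
      sumBelow (suc a + (m + r)) h                                 ≡⟨ sumBelow-+ (suc a) (m + r) h ⟩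
      sumBelow (suc a) h + sumBelow (m + r) (λ i → h (suc a + i))
        ≡⟨ cong₂ _+_ leftwards (rightwards (suc a) r B size refl) ⟩
      vCount a (suc m) r + vRight (suc a) m r                      ≡⟨ +-identityʳ _ ⟨
      vCount (suc a) m r                                           ∎
      where
      open ≡-Reasoning
      X = cars W ++ holes r
      L = holes (suc a) ++ X
      h = λ p → completions (parkCar p m L) (suc m) (a + r)
      dead : ∀ p → p < a → h p ≡ 0
      dead p p<a with <⇒∃+suc p<a
      ... | d , refl = begin
        h p ≡⟨ cong (λ l → completions (parkCar p m (holes l ++ X)) (suc m) (a + r)) (sym (+-suc p (suc d))) ⟩
        completions (parkCar p m (holes (p + suc (suc d)) ++ X)) (suc m) (a + r)
          ≡⟨ cong (λ l → completions l (suc m) (a + r))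
               (trans (parkCar-holes p (suc d) m X) (sym (++-assoc (holes p) (just m ∷ []) _))) ⟩
        completions ((holes p ++ just m ∷ []) ++ nothing ∷ holes d ++ X) (suc m) (a + r)
          ≡⟨ completions-dead (a + r) (dead-holeBetween (holes p ++ just m ∷ []) (holes d ++ X)
               (∈-parked-++ʳ (holes p) (just m ∷ []) (here refl))
               (∈-parked-++ʳ (holes d) X (∈-parked-++ˡ (cars W) (holes r) (∈-parked-cars (VBlock.0∈ B))))
               (λ m<y → there (here (Is231⇒orderIso (VBlock.0<m B , m<y))))) ⟩
        0 ∎
      leftwards : sumBelow (suc a) h ≡ vCount a (suc m) r
      leftwards = begin
        sumBelow (suc a) h  ≡⟨ sumBelow-last a h dead ⟩
        h a                 ≡⟨ cong (λ l → completions (parkCar a m (holes l ++ X)) (suc m) (a + r)) (+-comm 1 a) ⟩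
        completions (parkCar a m (holes (a + 1) ++ X)) (suc m) (a + r)
          ≡⟨ cong (λ l → completions l (suc m) (a + r)) (parkCar-holes a 0 m X) ⟩
        completions (holes a ++ cars (m ∷ W) ++ holes r) (suc m) (a + r)
          ≡⟨ completionsV a r (VBlock-prepend B) (trans (+-suc a (m + r)) size) ⟩
        vCount a (suc m) r  ∎

    rightwards : ∀ a r {m W} → VBlock m W → a + (m + r) ≡ n → ∀ {k} → a + r ≡ suc k →
      sumBelow (m + r) (λ i → completions (parkCar (a + i) m (holes a ++ cars W ++ holes r)) (suc m) k) ≡ vRight a m r
    rightwards a zero {m} {W} B size {k} a+0≡1+k = trans (sumBelow-cong (m + 0) stuck) (sumBelow-zero (m + 0))
      where
      L = holes a ++ cars W ++ []
      stuck : ∀ i → i < m + 0 → completions (parkCar (a + i) m L) (suc m) k ≡ 0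
      stuck i i<m = trans
        (cong (λ l → completions l (suc m) k)
          (trans (parkCar-skipHoles a i m (cars W ++ [])) (cong (holes a ++_) (parkCar-cars W i≤l m []))))
        (dead-tooFewCars L (suc m) k short)
        where
        i≤l : i ≤ length W
        i≤l = ≤-trans (<⇒≤ i<m) (≤-reflexive (trans (+-identityʳ m) (sym (VBlock.length≡ B))))
        short : k < countHoles L
        short = subst (k <_) (sym (trans (countHoles-holes a _) (cong (a +_) (countHoles-cars W []))))
                  (subst (k <_) (sym a+0≡1+k) (n<1+n k))
    rightwards a (suc r) {m} {W} B size {k} a+r≡k = begin
      sumBelow (m + suc r) h  ≡⟨ cong (λ t → sumBelow t h) (+-suc m r) ⟩
      sumBelow (suc m + r) h  ≡⟨ sumBelow-block (suc m) r h adjacent dead ⟩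
      suc m * vCount a (suc m) r ∎
      where
      open ≡-Reasoning
      L = holes a ++ cars W ++ holes (suc r)
      h = λ i → completions (parkCar (a + i) m L) (suc m) k
      k≡a+r : k ≡ a + r
      k≡a+r = suc-injective (trans (sym a+r≡k) (+-suc a r))
      adjacent : ∀ i → i < suc m → h i ≡ vCount a (suc m) r
      adjacent i i≤m = begin
        h i ≡⟨ cong₂ (λ l j → completions l (suc m) j)
                 (trans (parkCar-skipHoles a i m _) (cong (holes a ++_) (parkCar-afterCars W i≤l m (holes r))))
                 k≡a+r ⟩
        completions (holes a ++ cars (W ++ m ∷ []) ++ holes r) (suc m) (a + r)
          ≡⟨ completionsV a r (VBlock-append B) (trans (cong (a +_) (sym (+-suc m r))) size) ⟩
        vCount a (suc m) r ∎
        where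
        i≤l : i ≤ length W
        i≤l = ≤-trans (≤-pred i≤m) (≤-reflexive (sym (VBlock.length≡ B)))
      dead : ∀ j → j < r → h (suc m + j) ≡ 0
      dead j j<r = begin
        h (suc m + j) ≡⟨ cong (λ l → completions l (suc m) k) (trans (parkCar-skipHoles a (suc m + j) m _)
                           (cong (holes a ++_) (trans (cong (λ q → parkCar q m (cars W ++ holes (suc r))) (sym (+-suc m j)))
                             (parkCar-skip (cars W) (trans (length-map just W) (VBlock.length≡ B)) (suc j) m (holes (suc r)))))) ⟩
        completions (holes a ++ cars W ++ nothing ∷ parkCar j m (holes r)) (suc m) k
          ≡⟨ cong (λ l → completions l (suc m) k) (sym (++-assoc (holes a) (cars W) _)) ⟩
        completions ((holes a ++ cars W) ++ nothing ∷ parkCar j m (holes r)) (suc m) k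
          ≡⟨ completions-dead k (dead-holeBetween (holes a ++ cars W) (parkCar j m (holes r))
               (∈-parked-++ʳ (holes a) (cars W) (∈-parked-cars (VBlock.0∈ B))) (∈-parked-parkCar-holes j<r m)
               (λ m<y → here (Is132⇒orderIso (VBlock.0<m B , m<y)))) ⟩
        0 ∎

  completions-V : ∀ k → n ≡ suc k → completions (holes n) 0 n ≡ 3 ↑ k
  completions-V k refl = begin
    completions (holes (suc k)) 0 (suc k)
      ≡⟨ completions-suc (holes (suc k)) 0 k ⟩
    sumBelow (suc k) (λ p → completions (parkCar p 0 (holes (suc k))) 1 k)
      ≡⟨ sumBelow-cong (suc k) firstCar ⟩
    sumBelow (suc k) (λ p → vCount p 1 (k ∸ p))
      ≡⟨ sumAntidiagonal-sumBelow k (λ a r → vCount a 1 r) ⟨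
    sumAntidiagonal k (λ a r → vCount a 1 r)
      ≡⟨ sum-vCount k 1 ⟩
    3 ↑ k ∎
    where
    open ≡-Reasoning
    firstCar : ∀ p → p < suc k → completions (parkCar p 0 (holes (suc k))) 1 k ≡ vCount p 1 (k ∸ p)
    firstCar p p<1+k with <⇒∃+suc p<1+k
    ... | d , 1+k≡p+1+d = begin
      completions (parkCar p 0 (holes (suc k))) 1 k
        ≡⟨ cong₂ (λ l j → completions (parkCar p 0 (holes l)) 1 j) 1+k≡p+1+d k≡p+d ⟩
      completions (parkCar p 0 (holes (p + suc d))) 1 (p + d)
        ≡⟨ cong (λ l → completions l 1 (p + d)) (parkCar-holesOnly p d 0) ⟩
      completions (holes p ++ cars (0 ∷ []) ++ holes d) 1 (p + d)
        ≡⟨ completionsV p d VBlock-start (sym 1+k≡p+1+d) ⟩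
      vCount p 1 d
        ≡⟨ cong (vCount p 1) (trans (sym (m+n∸m≡n p d)) (cong (_∸ p) (sym k≡p+d))) ⟩
      vCount p 1 (k ∸ p) ∎
      where
      k≡p+d : k ≡ p + d
      k≡p+d = suc-injective (trans 1+k≡p+1+d (+-suc p d))


-- Avoiding 231 and 312

lCount : ℕ → ℕ → ℕ
lCount m zero    = 1
lCount m (suc r) = suc m * (3 + m) ↑ r

sum-lCount : ∀ r m → sumAntidiagonal r (λ a b → lCount (a + m) b) ≡ (2 + m) ↑ r
sum-lCount zero    m = refl
sum-lCount (suc r) m = begin
  lCount m (suc r) + sumAntidiagonal r (λ a b → lCount (suc a + m) b)
    ≡⟨ cong (lCount m (suc r) +_) (sumAntidiagonal-cong r (λ a b → cong (λ x → lCount x b) (sym (+-suc a m)))) ⟩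
  lCount m (suc r) + sumAntidiagonal r (λ a b → lCount (a + suc m) b)
    ≡⟨ cong (lCount m (suc r) +_) (sum-lCount r (suc m)) ⟩
  suc m * (3 + m) ↑ r + (3 + m) ↑ r
    ≡⟨ +-comm (suc m * (3 + m) ↑ r) _ ⟩
  (2 + m) ↑ suc r ∎
  where open ≡-Reasoning

AvoidsL : List ℕ → Set
AvoidsL W = Avoids Is231 W × Avoids Is312 W

avoidsL-insert : ∀ c U V → All (_< c) (U ++ V) → U ≪ V → Descending V → AvoidsL (U ++ V) → AvoidsL (U ++ c ∷ V)
avoidsL-insert c U V below U≪V desc (av231 , av312) =
  avoids-insert Is231 U V c av231
    (λ yz⊆V (_ , c<y) → <-asym c<y (belowV (to∈ yz⊆V)))
    (λ x∈U z∈V (z<x , _) → <-asym z<x (U≪V x∈U z∈V))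
    (λ xy⊆U (c<x , _) → <-asym c<x (belowU (to∈ xy⊆U)))
  , avoids-insert Is312 U V c av312
    (λ yz⊆V (y<z , _) → <-asym y<z (desc yz⊆V))
    (λ _ z∈V (c<z , _) → <-asym c<z (belowV z∈V))
    (λ xy⊆U (_ , c<x) → <-asym c<x (belowU (to∈ xy⊆U)))
  where
  belowU : ∀ {x} → x ∈ U → x < c
  belowU = All.lookup (All.++⁻ˡ U below)
  belowV : ∀ {x} → x ∈ V → x < c
  belowV = All.lookup (All.++⁻ʳ U below)

record LBlock (m : ℕ) (W : List ℕ) : Set where
  field
    length≡ : length W ≡ m
    below   : All (_< m) W
    avoidsL : AvoidsL W

record LGap (m₁ k₂ : ℕ) (W₁ W₂ : List ℕ) : Set where
  field
    length₁  : length W₁ ≡ m₁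
    length₂  : length W₂ ≡ k₂
    below    : All (_< m₁ + k₂) (W₁ ++ W₂)
    avoidsL  : AvoidsL (W₁ ++ W₂)
    W₁≪W₂    : W₁ ≪ W₂
    desc     : Descending W₂

LBlock-empty : LBlock 0 []
LBlock-empty = record { length≡ = refl ; below = [] ; avoidsL = (λ ()) , (λ ()) }

private
  append-below : ∀ {m W} → LBlock m W → All (_< suc m) (W ++ m ∷ [])
  append-below {m} {W} B = All-<-insert W [] (subst (All (_< m)) (sym (++-identityʳ W)) (LBlock.below B))

  append-avoids : ∀ {m W} → LBlock m W → AvoidsL (W ++ m ∷ [])
  append-avoids {m} {W} B = avoidsL-insert m W []
    (subst (All (_< m)) (sym (++-identityʳ W)) (LBlock.below B)) (λ _ ()) (λ ())
    (subst AvoidsL (sym (++-identityʳ W)) (LBlock.avoidsL B))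

  append-length : ∀ {m W} → LBlock m W → length (W ++ m ∷ []) ≡ suc m
  append-length {m} {W} B = trans (length-++ W) (trans (+-comm (length W) 1) (cong suc (LBlock.length≡ B)))

LBlock-append : ∀ {m W} → LBlock m W → LBlock (suc m) (W ++ m ∷ [])
LBlock-append B = record { length≡ = append-length B ; below = append-below B ; avoidsL = append-avoids B }

LBlock-gap : ∀ {m W} → LBlock m W → LGap m 1 W (m ∷ [])
LBlock-gap {m} {W} B = record
  { length₁  = LBlock.length≡ B
  ; length₂  = refl
  ; below    = subst (λ k → All (_< k) (W ++ m ∷ [])) (+-comm 1 m) (append-below B)
  ; avoidsL  = append-avoids B
  ; W₁≪W₂    = λ { x∈W (here refl) → All.lookup (LBlock.below B) x∈W }
  ; desc     = λ { (_ ∷ʳ ()) ; (_ ∷ ()) }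
  }

module _ {m₁ k₂ W₁ W₂} (G : LGap m₁ k₂ W₁ W₂) where
  open LGap G

  LGap-close : LBlock (suc (m₁ + k₂)) (W₁ ++ (m₁ + k₂) ∷ W₂)
  LGap-close = record
    { length≡ = trans (length-++ W₁) (trans (cong₂ _+_ length₁ (cong suc length₂)) (+-suc m₁ k₂))
    ; below   = All-<-insert W₁ W₂ below
    ; avoidsL = avoidsL-insert (m₁ + k₂) W₁ W₂ below W₁≪W₂ desc avoidsL
    }

  LGap-extend : LGap m₁ (suc k₂) W₁ ((m₁ + k₂) ∷ W₂)
  LGap-extend = record
    { length₁  = length₁
    ; length₂  = cong suc length₂
    ; below    = subst (λ k → All (_< k) (W₁ ++ (m₁ + k₂) ∷ W₂)) (sym (+-suc m₁ k₂)) (All-<-insert W₁ W₂ below)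
    ; avoidsL  = avoidsL-insert (m₁ + k₂) W₁ W₂ below W₁≪W₂ desc avoidsL
    ; W₁≪W₂    = λ { x∈W₁ (here refl)    → All.lookup (All.++⁻ˡ W₁ below) x∈W₁
                   ; x∈W₁ (there z∈W₂) → W₁≪W₂ x∈W₁ z∈W₂ }
    ; desc     = Descending-∷ (All.++⁻ʳ W₁ below) desc
    }

module CompletionsL (n : ℕ) where
  open Completions n (p231 ∷ p312 ∷ [])

  private
    good-L : ∀ {m W} → LBlock m W → good (cars W ++ []) ≡ true
    good-L {W = W} B rewrite ++-identityʳ (cars W) = good-cars W (all-avoids-pair W p231 p312
      (avoids-true p231 refl orderIso⇒Is231 (proj₁ (LBlock.avoidsL B)))
      (avoids-true p312 refl orderIso⇒Is312 (proj₂ (LBlock.avoidsL B))))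

  module _ {m₁ k₂ W₁ w V} (G : LGap m₁ k₂ W₁ (w ∷ V)) where
    open LGap G

    private
      c : ℕ
      c = m₁ + k₂

      w<c : w < c
      w<c = All.lookup (All.++⁻ʳ W₁ below) (here refl)

    dead-inGap : ∀ i j R k →
      completions (cars W₁ ++ holes i ++ just c ∷ nothing ∷ holes j ++ cars (w ∷ V) ++ R) (suc c) k ≡ 0
    dead-inGap i j R k = trans
      (cong (λ l → completions l (suc c) k)
        (trans (cong (cars W₁ ++_) (sym (++-assoc (holes i) (just c ∷ []) _))) (sym (++-assoc (cars W₁) (holes i ++ _) _))))
      (completions-dead k (dead-holeBetween (cars W₁ ++ holes i ++ just c ∷ []) (holes j ++ cars (w ∷ V) ++ R)
        (∈-parked-++ʳ (cars W₁) _ (∈-parked-++ʳ (holes i) _ (here refl)))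
        (∈-parked-++ʳ (holes j) _ (∈-parked-++ˡ (cars (w ∷ V)) R (here refl)))
        (λ c<y → here (Is231⇒orderIso (w<c , c<y)))))

    dead-pastGap : ∀ g r i → i < k₂ + r →
      completions (cars W₁ ++ holes (suc g) ++ parkCar i c (cars (w ∷ V) ++ holes r)) (suc c) (g + r) ≡ 0
    dead-pastGap g zero i i<k₂ = trans
      (cong (λ l → completions (cars W₁ ++ holes (suc g) ++ l) (suc c) (g + 0))
        (parkCar-cars (w ∷ V) (≤-trans (<⇒≤ i<k₂) (≤-reflexive (trans (+-identityʳ k₂) (sym length₂)))) c []))
      (dead-tooFewCars _ (suc c) (g + 0) (subst (g + 0 <_) (sym holesCount) (n<1+n (g + 0))))
      where
      holesCount : countHoles (cars W₁ ++ holes (suc g) ++ cars (w ∷ V) ++ []) ≡ suc g + 0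
      holesCount = trans (countHoles-cars W₁ _)
                         (trans (countHoles-holes (suc g) _) (cong (suc g +_) (countHoles-cars (w ∷ V) [])))
    dead-pastGap g (suc r) i i< with parkCar-pastCars (w ∷ V) (subst (λ l → i < l + suc r) (sym length₂) i<) c
    ... | S , eq , c∈S = trans
      (cong (λ l → completions (cars W₁ ++ holes (suc g) ++ l) (suc c) (g + suc r)) eq)
      (completions-dead (g + suc r) (dead-holeBefore (cars W₁) (holes g ++ cars (w ∷ V) ++ S)
        (subst (_ ⊆_) (sym (trans (parked-holes g _) (parked-cars (w ∷ V) S))) (++⁺ (from∈ (here refl)) (from∈ c∈S)))
        (λ c<x → there (here (Is312⇒orderIso (w<c , c<x))))))

  mutual
    completionsL : ∀ r {m W} → LBlock m W → m + r ≡ n → completions (cars W ++ holes r) m r ≡ lCount m r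
    completionsL zero    {m} {W} B _    = completions-zero (cars W ++ []) m (good-L B)
    completionsL (suc r) {m} {W} B size = begin
      completions L m (suc r)
        ≡⟨ completions-suc L m r ⟩
      sumBelow n h
        ≡⟨ cong (λ t → sumBelow t h) (trans (sym size) (+-suc m r)) ⟩
      sumBelow (suc m + r) h
        ≡⟨ sumBelow-+ (suc m) r h ⟩
      sumBelow (suc m) h + sumBelow r (λ g → h (suc m + g))
        ≡⟨ cong₂ _+_ (trans (sumBelow-cong (suc m) append) (sumBelow-const (suc m) _))
                     (trans (sumBelow-cong r gap) (sumBelow-*ˡ r (suc m) _)) ⟩
      suc m * lCount (suc m) r + suc m * sumBelow r (λ g → lCount (suc g + suc m) (r ∸ suc g))
        ≡⟨ *-distribˡ-+ (suc m) (lCount (suc m) r) (sumBelow r (λ g → lCount (suc g + suc m) (r ∸ suc g))) ⟨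
      suc m * sumBelow (suc r) (λ a → lCount (a + suc m) (r ∸ a))
        ≡⟨ cong (suc m *_) (sumAntidiagonal-sumBelow r (λ a b → lCount (a + suc m) b)) ⟨
      suc m * sumAntidiagonal r (λ a b → lCount (a + suc m) b)
        ≡⟨ cong (suc m *_) (sum-lCount r (suc m)) ⟩
      lCount m (suc r) ∎
      where
      open ≡-Reasoning
      L = cars W ++ holes (suc r)
      h = λ p → completions (parkCar p m L) (suc m) r
      append : ∀ p → p < suc m → h p ≡ lCount (suc m) r
      append p p≤m = trans
        (cong (λ l → completions l (suc m) r)
          (parkCar-afterCars W (≤-trans (≤-pred p≤m) (≤-reflexive (sym (LBlock.length≡ B)))) m (holes r)))
        (completionsL r (LBlock-append B) (trans (sym (+-suc m r)) size))
      gap : ∀ g → g < r → h (suc m + g) ≡ suc m * lCount (suc g + suc m) (r ∸ suc g)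
      gap g g<r with <⇒∃+suc g<r
      ... | d , r≡g+1+d = begin
        h (suc m + g)
          ≡⟨ cong (λ l → completions l (suc m) r)
               (trans (cong (λ p → parkCar p m L) (sym (+-suc m g)))
                 (trans (parkCar-skipCars W (LBlock.length≡ B) (suc g) m _)
                   (cong (λ l → cars W ++ nothing ∷ l)
                     (trans (cong (λ l → parkCar g m (holes l)) r≡g+1+d) (parkCar-holesOnly g d m))))) ⟩
        completions (cars W ++ holes (suc g) ++ cars (m ∷ []) ++ holes d) (suc m) r
          ≡⟨ cong (λ c → completions (cars W ++ holes (suc g) ++ cars (m ∷ []) ++ holes d) c r) (+-comm 1 m) ⟩
        completions (cars W ++ holes (suc g) ++ cars (m ∷ []) ++ holes d) (m + 1) r
          ≡⟨ completionsGap r g d (trans r≡g+1+d (+-suc g d)) (LBlock-gap B)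
               (trans (cong (λ l → m + suc l) (sym r≡g+1+d)) size) ⟩
        suc m * lCount (m + suc g + 1) d
          ≡⟨ cong₂ (λ x y → suc m * lCount x y) (arith m g)
               (sym (trans (cong (_∸ suc g) (trans r≡g+1+d (+-suc g d))) (m+n∸m≡n (suc g) d))) ⟩
        suc m * lCount (suc g + suc m) (r ∸ suc g) ∎
        where
        arith : ∀ m g → m + suc g + 1 ≡ suc g + suc m
        arith = solve-∀

    -- The number t = suc g + r of cars to come is a separate argument to make the
    -- mutual recursion structural.
    completionsGap : ∀ t g r {m₁ k₂ W₁ w V} → t ≡ suc g + r → LGap m₁ k₂ W₁ (w ∷ V) →
      m₁ + (suc g + (k₂ + r)) ≡ n →
      completions (cars W₁ ++ holes (suc g) ++ cars (w ∷ V) ++ holes r) (m₁ + k₂) t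
        ≡ suc m₁ * lCount (m₁ + suc g + k₂) r
    completionsGap (suc r) zero .r {m₁} {k₂} {W₁} {w} {V} refl G size = begin
      completions L c (suc r)
        ≡⟨ completions-suc L c r ⟩
      sumBelow n h
        ≡⟨ cong (λ t → sumBelow t h) (trans (sym size) (+-suc m₁ (k₂ + r))) ⟩
      sumBelow (suc m₁ + (k₂ + r)) h
        ≡⟨ sumBelow-block (suc m₁) (k₂ + r) h close past ⟩
      suc m₁ * lCount (suc c) r
        ≡⟨ cong (λ x → suc m₁ * lCount x r) (arith m₁ k₂) ⟩
      suc m₁ * lCount (m₁ + 1 + k₂) r ∎
      where
      open ≡-Reasoning
      open LGap G
      c = m₁ + k₂
      Y = cars (w ∷ V) ++ holes r
      L = cars W₁ ++ holes 1 ++ Y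
      h = λ p → completions (parkCar p c L) (suc c) r
      arith : ∀ m₁ k₂ → suc (m₁ + k₂) ≡ m₁ + 1 + k₂
      arith = solve-∀
      arith′ : ∀ m₁ k₂ r → suc (m₁ + k₂) + r ≡ m₁ + suc (k₂ + r)
      arith′ = solve-∀
      close : ∀ p → p < suc m₁ → h p ≡ lCount (suc c) r
      close p p≤m₁ = trans
        (cong (λ l → completions l (suc c) r)
          (trans (parkCar-cars W₁ (≤-trans (≤-pred p≤m₁) (≤-reflexive (sym length₁))) c (nothing ∷ Y))
                 (cars-++ W₁ (c ∷ w ∷ V) (holes r))))
        (completionsL r (LGap-close G) (trans (arith′ m₁ k₂ r) size))
      past : ∀ j → j < k₂ + r → h (suc m₁ + j) ≡ 0
      past j j< = trans
        (cong (λ l → completions l (suc c) r)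
          (trans (cong (λ p → parkCar p c L) (sym (+-suc m₁ j))) (parkCar-skipCars W₁ length₁ (suc j) c (nothing ∷ Y))))
        (dead-pastGap G 0 r j j<)
    completionsGap (suc t) (suc g) r {m₁} {k₂} {W₁} {w} {V} t≡ G size = begin
      completions L c (suc t)
        ≡⟨ completions-suc L c t ⟩
      sumBelow n h
        ≡⟨ cong (λ t → sumBelow t h) (trans (sym size) (arith₁ m₁ g (k₂ + r))) ⟩
      sumBelow ((m₁ + suc g) + suc (k₂ + r)) h
        ≡⟨ sumBelow-+ (m₁ + suc g) (suc (k₂ + r)) h ⟩
      sumBelow (m₁ + suc g) h + (h (m₁ + suc g + 0) + sumBelow (k₂ + r) (λ i → h (m₁ + suc g + suc i)))
        ≡⟨ cong₂ _+_ (trans (sumBelow-cong (m₁ + suc g) inGap) (sumBelow-zero (m₁ + suc g)))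
                     (cong₂ _+_ adjacent (trans (sumBelow-cong (k₂ + r) past) (sumBelow-zero (k₂ + r)))) ⟩
      0 + (suc m₁ * lCount (m₁ + suc (suc g) + k₂) r + 0)
        ≡⟨ +-identityʳ _ ⟩
      suc m₁ * lCount (m₁ + suc (suc g) + k₂) r ∎
      where
      open ≡-Reasoning
      open LGap G
      c = m₁ + k₂
      Y = cars (w ∷ V) ++ holes r
      L = cars W₁ ++ holes (suc (suc g)) ++ Y
      h = λ p → completions (parkCar p c L) (suc c) t
      t≡′ : t ≡ suc g + r
      t≡′ = suc-injective t≡
      arith₁ : ∀ m₁ g x → m₁ + (suc (suc g) + x) ≡ (m₁ + suc g) + suc x
      arith₁ = solve-∀
      inGap : ∀ p → p < m₁ + suc g → h p ≡ 0
      inGap p p< with parkCar-intoGap W₁ (subst (λ l → p < l + suc g) (sym length₁) p<) c Y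
      ... | i , j , eq = trans (cong₂ (λ l k → completions l (suc c) k) eq t≡′) (dead-inGap G i j (holes r) (suc g + r))
      adjacent : h (m₁ + suc g + 0) ≡ suc m₁ * lCount (m₁ + suc (suc g) + k₂) r
      adjacent = begin
        h (m₁ + suc g + 0)
          ≡⟨ cong (λ l → completions l (suc c) t)
               (trans (cong (λ p → parkCar p c L) (+-identityʳ _))
                 (trans (parkCar-skipCars W₁ length₁ (suc g) c _)
                   (cong (cars W₁ ++_) (trans (cong (λ l → parkCar (suc g) c (holes l ++ Y)) (+-comm 1 (suc g))) (parkCar-holes (suc g) 0 c Y))))) ⟩
        completions (cars W₁ ++ holes (suc g) ++ cars (c ∷ w ∷ V) ++ holes r) (suc c) t
          ≡⟨ cong (λ x → completions (cars W₁ ++ holes (suc g) ++ cars (c ∷ w ∷ V) ++ holes r) x t) (sym (+-suc m₁ k₂)) ⟩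
        completions (cars W₁ ++ holes (suc g) ++ cars (c ∷ w ∷ V) ++ holes r) (m₁ + suc k₂) t
          ≡⟨ completionsGap t g r t≡′ (LGap-extend G) (trans (cong (m₁ +_) (arith₂ g k₂ r)) size) ⟩
        suc m₁ * lCount (m₁ + suc g + suc k₂) r
          ≡⟨ cong (λ x → suc m₁ * lCount x r) (arith₃ m₁ g k₂) ⟩
        suc m₁ * lCount (m₁ + suc (suc g) + k₂) r ∎
        where
        arith₂ : ∀ g k₂ r → suc g + (suc k₂ + r) ≡ suc (suc g) + (k₂ + r)
        arith₂ = solve-∀
        arith₃ : ∀ m₁ g k₂ → m₁ + suc g + suc k₂ ≡ m₁ + suc (suc g) + k₂
        arith₃ = solve-∀
      past : ∀ i → i < k₂ + r → h (m₁ + suc g + suc i) ≡ 0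
      past i i< = trans
        (cong₂ (λ l k → completions l (suc c) k)
          (trans (cong (λ p → parkCar p c L) (arith₄ m₁ g i))
            (trans (parkCar-skipCars W₁ length₁ (suc (suc g) + i) c _)
              (cong (cars W₁ ++_) (parkCar-skipHoles (suc (suc g)) i c Y))))
          t≡′)
        (dead-pastGap G (suc g) r i i<)
        where
        arith₄ : ∀ m₁ g i → m₁ + suc g + suc i ≡ m₁ + (suc (suc g) + i)
        arith₄ = solve-∀

  completions-L : ∀ k → n ≡ suc k → completions (holes n) 0 n ≡ 3 ↑ k
  completions-L k n≡1+k = trans (completionsL n LBlock-empty refl)
                                (trans (cong (lCount 0) n≡1+k) (+-identityʳ (3 ↑ k)))


-- Avoiding 132 and 312

holeWeight : ℕ → Lot → ℕ
holeWeight i []            = 1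
holeWeight i (just x ∷ R)  = holeWeight (suc i) R
holeWeight i (nothing ∷ R) = suc i * holeWeight (suc i) R

holeWeight-holes : ∀ i j R → holeWeight i (holes j ++ R) ≡ suc i ↑ j * holeWeight (i + j) R
holeWeight-holes i zero    R = trans (cong (λ x → holeWeight x R) (sym (+-identityʳ i))) (sym (*-identityˡ _))
holeWeight-holes i (suc j) R = begin
  suc i * holeWeight (suc i) (holes j ++ R)                ≡⟨ cong (suc i *_) (holeWeight-holes (suc i) j R) ⟩
  suc i * (suc (suc i) ↑ j * holeWeight (suc i + j) R)     ≡⟨ *-assoc (suc i) (suc (suc i) ↑ j) (holeWeight (suc i + j) R) ⟨
  suc i ↑ suc j * holeWeight (suc i + j) R                 ≡⟨ cong (λ x → suc i ↑ suc j * holeWeight x R) (+-suc i j) ⟨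
  suc i ↑ suc j * holeWeight (i + suc j) R                 ∎
  where open ≡-Reasoning

AvoidsR : List ℕ → Set
AvoidsR W = Avoids Is132 W × Avoids Is312 W

avoidsR-insert : ∀ c U V → All (_< c) (U ++ V) → V ≪ U → Descending V → AvoidsR (U ++ V) → AvoidsR (U ++ c ∷ V)
avoidsR-insert c U V below V≪U desc (av132 , av312) =
  avoids-insert Is132 U V c av132
    (λ yz⊆V (c<z , _) → <-asym c<z (belowV (to∈ (∷ˡ⁻ yz⊆V))))
    (λ x∈U z∈V (x<z , _) → <-asym x<z (V≪U z∈V x∈U))
    (λ xy⊆U (_ , c<y) → <-asym c<y (belowU (to∈ (∷ˡ⁻ xy⊆U))))
  , avoids-insert Is312 U V c av312
    (λ yz⊆V (y<z , _) → <-asym y<z (desc yz⊆V))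
    (λ _ z∈V (c<z , _) → <-asym c<z (belowV z∈V))
    (λ xy⊆U (_ , c<x) → <-asym c<x (belowU (to∈ xy⊆U)))
  where
  belowU : ∀ {x} → x ∈ U → x < c
  belowU = All.lookup (All.++⁻ˡ U below)
  belowV : ∀ {x} → x ∈ V → x < c
  belowV = All.lookup (All.++⁻ʳ U below)

Descending⇒AvoidsR : ∀ {W} → Descending W → AvoidsR W
Descending⇒AvoidsR desc =
    (λ xyz⊆W (x<z , _) → <-asym x<z (desc (⊆-trans (refl ∷ _ ∷ʳ refl ∷ []) xyz⊆W)))
  , (λ xyz⊆W (y<z , _) → <-asym y<z (desc (⊆-trans (_ ∷ʳ ⊆-refl) xyz⊆W)))

record RFront (m c : ℕ) (A : List ℕ) (R : Lot) : Set where
  field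
    length≡ : length A ≡ m
    below   : All (_< c) (A ++ parked R)
    avoidsR : AvoidsR (A ++ parked R)
    desc    : Descending (parked R)
    R≪A     : parked R ≪ A

module _ {m c : ℕ} {A : List ℕ} where
  open RFront

  RFront-shift : ∀ {x R} → RFront m c A (just x ∷ R) → RFront (suc m) c (A ++ x ∷ []) R
  RFront-shift {x} {R} F = record
    { length≡ = trans (length-++ A) (trans (+-comm (length A) 1) (cong suc (length≡ F)))
    ; below   = subst (All (_< c)) (sym (++-assoc A (x ∷ []) (parked R))) (below F)
    ; avoidsR = subst AvoidsR (sym (++-assoc A (x ∷ []) (parked R))) (avoidsR F)
    ; desc    = λ yz⊆R → desc F (x ∷ʳ yz⊆R)
    ; R≪A     = λ z∈R y∈ →
        [ R≪A F (there z∈R) , (λ { (here refl) → desc F (refl ∷ from∈ z∈R) }) ]′ (∈-++⁻ A y∈)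
    }

  RFront-fill : ∀ {R} → RFront m c A (nothing ∷ R) → RFront (suc m) (suc c) (A ++ c ∷ []) R
  RFront-fill {R} F = record
    { length≡ = trans (length-++ A) (trans (+-comm (length A) 1) (cong suc (length≡ F)))
    ; below   = subst (All (_< suc c)) (sym (++-assoc A (c ∷ []) (parked R))) (All-<-insert A (parked R) (below F))
    ; avoidsR = subst AvoidsR (sym (++-assoc A (c ∷ []) (parked R)))
                  (avoidsR-insert c A (parked R) (below F) (R≪A F) (desc F) (avoidsR F))
    ; desc    = desc F
    ; R≪A     = λ z∈R y∈ →
        [ R≪A F z∈R , (λ { (here refl) → All.lookup (All.++⁻ʳ A (below F)) z∈R }) ]′ (∈-++⁻ A y∈)
    }

RFront-start : ∀ {c R} → All (_< c) (parked R) → Descending (parked R) → RFront 1 (suc c) (c ∷ []) R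
RFront-start {c} below desc = record
  { length≡ = refl
  ; below   = n<1+n c ∷ All.map m<n⇒m<1+n below
  ; avoidsR = Descending⇒AvoidsR (Descending-∷ below desc)
  ; desc    = desc
  ; R≪A     = λ { z∈R (here refl) → All.lookup below z∈R }
  }

data NoLeadingHole : Lot → Set where
  empty : NoLeadingHole []
  car   : ∀ {x R} → NoLeadingHole (just x ∷ R)

module CompletionsR (n : ℕ) where
  open Completions n (p132 ∷ p312 ∷ [])

  completionsFront : ∀ k R {m c a₀ A} → k ≡ countHoles R → RFront m c (a₀ ∷ A) R → m + length R ≡ n →
                     completions (cars (a₀ ∷ A) ++ R) c k ≡ holeWeight m R
  completionsFront zero [] {m} {c} {a₀} {A} _ F _ = completions-zero (cars (a₀ ∷ A) ++ []) c
    (subst (λ l → good l ≡ true) (sym (++-identityʳ (cars (a₀ ∷ A)))) (good-cars (a₀ ∷ A)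
      (all-avoids-pair (a₀ ∷ A) p132 p312
        (avoids-true p132 refl orderIso⇒Is132 (proj₁ avoidsR′)) (avoids-true p312 refl orderIso⇒Is312 (proj₂ avoidsR′)))))
    where
    avoidsR′ : AvoidsR (a₀ ∷ A)
    avoidsR′ = subst AvoidsR (++-identityʳ (a₀ ∷ A)) (RFront.avoidsR F)
  completionsFront k (just x ∷ R) {m} {c} {a₀} {A} k≡ F size = trans
    (cong (λ l → completions l c k) (cars-∷ʳ (a₀ ∷ A) x R))
    (completionsFront k R k≡ (RFront-shift F) (trans (sym (+-suc m (length R))) size))
  completionsFront (suc k) (nothing ∷ R) {m} {c} {a₀} {A} k≡ F size = begin
    completions L c (suc k)             ≡⟨ completions-suc L c k ⟩
    sumBelow n h                        ≡⟨ cong (λ t → sumBelow t h) (trans (sym size) (+-suc m (length R))) ⟩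
    sumBelow (suc m + length R) h       ≡⟨ sumBelow-block (suc m) (length R) h atFront dead ⟩
    suc m * holeWeight (suc m) R        ∎
    where
    open ≡-Reasoning
    L = cars (a₀ ∷ A) ++ nothing ∷ R
    h = λ p → completions (parkCar p c L) (suc c) k
    atFront : ∀ p → p < suc m → h p ≡ holeWeight (suc m) R
    atFront p p≤m = trans
      (cong (λ l → completions l (suc c) k)
        (parkCar-afterCars (a₀ ∷ A) (≤-trans (≤-pred p≤m) (≤-reflexive (sym (RFront.length≡ F)))) c R))
      (completionsFront k R (suc-injective k≡) (RFront-fill F) (trans (sym (+-suc m (length R))) size))
    dead : ∀ i → i < length R → h (suc m + i) ≡ 0
    dead i _ = trans
      (cong (λ l → completions l (suc c) k)
        (trans (cong (λ p → parkCar p c L) (sym (+-suc m i)))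
          (parkCar-skipCars (a₀ ∷ A) (RFront.length≡ F) (suc i) c (nothing ∷ R))))
      (afterCar (parkCar-stuckOrParked i c R))
      where
      afterCar : parkCar i c R ≡ R ⊎ c ∈ parked (parkCar i c R) →
                 completions (cars (a₀ ∷ A) ++ nothing ∷ parkCar i c R) (suc c) k ≡ 0
      afterCar (inj₁ stuck) rewrite stuck = dead-tooFewCars L (suc c) k
        (subst (k <_) (sym (trans (countHoles-cars (a₀ ∷ A) _) (sym k≡))) (n<1+n k))
      afterCar (inj₂ c∈) = completions-dead k (dead-holeBetween (cars (a₀ ∷ A)) (parkCar i c R) (here refl) c∈
        (λ c<y → here (Is132⇒orderIso (All.lookup (RFront.below F) (here refl) , c<y))))

  dead-pastHoles : ∀ q R {c k} → NoLeadingHole R → All (_< c) (parked R) → k ≡ q + countHoles R →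
    ∀ i → i < length R → completions (parkCar (suc q + i) c (holes (suc q) ++ R)) (suc c) k ≡ 0
  dead-pastHoles q []            empty _     _  i ()
  dead-pastHoles q (just x₀ ∷ R) {c} {k} car below k≡ i _ = trans
    (cong (λ l → completions l (suc c) k)
      (trans (parkCar-skipHoles (suc q) i c _) (cong (holes (suc q) ++_) (parkCar-pastCar i c x₀ R))))
    (afterCar (parkCar-stuckOrParked (pred i) c R))
    where
    afterCar : parkCar (pred i) c R ≡ R ⊎ c ∈ parked (parkCar (pred i) c R) →
               completions (holes (suc q) ++ just x₀ ∷ parkCar (pred i) c R) (suc c) k ≡ 0
    afterCar (inj₁ stuck) rewrite stuck = dead-tooFewCars _ (suc c) k
      (subst (k <_) (sym (countHoles-holes (suc q) _)) (subst (_< suc q + countHoles R) (sym k≡) (n<1+n _)))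
    afterCar (inj₂ c∈) = trans
      (cong (λ l → completions l (suc c) k) (holes-suc q _))
      (completions-dead k (dead-holeBefore (holes q) (just x₀ ∷ parkCar (pred i) c R) (refl ∷ from∈ c∈)
        (λ c<x → there (here (Is312⇒orderIso (All.lookup below (here refl) , c<x))))))

  completionsHoles : ∀ k q R {c} → k ≡ suc q + countHoles R → NoLeadingHole R →
                     All (_< c) (parked R) → Descending (parked R) →
                     suc q + length R ≡ n → completions (holes (suc q) ++ R) c k ≡ 3 ↑ q * holeWeight (suc q) R
  completionsHoles (suc k) q R {c} k≡ nlh below desc size = begin
    completions L c (suc k)
      ≡⟨ completions-suc L c k ⟩
    sumBelow n h
      ≡⟨ cong (λ t → sumBelow t h) (sym size) ⟩
    sumBelow (suc q + length R) h
      ≡⟨ sumBelow-+ (suc q) (length R) h ⟩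
    sumBelow (suc q) h + sumBelow (length R) (λ i → h (suc q + i))
      ≡⟨ cong₂ _+_ (sumBelow-2↑-3↑ q h (holeWeight (suc q) R) front later)
                   (trans (sumBelow-cong (length R) (dead-pastHoles q R nlh below k≡′)) (sumBelow-zero (length R))) ⟩
    3 ↑ q * holeWeight (suc q) R + 0
      ≡⟨ +-identityʳ _ ⟩
    3 ↑ q * holeWeight (suc q) R ∎
    where
    open ≡-Reasoning
    L = holes (suc q) ++ R
    h = λ p → completions (parkCar p c L) (suc c) k
    k≡′ : k ≡ q + countHoles R
    k≡′ = suc-injective k≡
    belowHoles : ∀ j → All (_< c) (parked (holes j ++ R))
    belowHoles j = subst (All (_< c)) (sym (parked-holes j R)) below
    desc′ : ∀ j → Descending (parked (holes j ++ R))
    desc′ j = subst Descending (sym (parked-holes j R)) desc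
    front : h 0 ≡ 2 ↑ q * holeWeight (suc q) R
    front = trans
      (completionsFront k (holes q ++ R) (trans k≡′ (sym (countHoles-holes q R)))
        (RFront-start (belowHoles q) (desc′ q)) (trans (cong suc (length-holes q R)) size))
      (holeWeight-holes 1 q R)
    later : ∀ p → p < q → h (suc p) ≡ 3 ↑ pred q * holeWeight (suc q) R
    later p p<q with <⇒∃+suc p<q
    ... | j , q≡p+1+j = begin
      h (suc p)
        ≡⟨ cong (λ l → completions (parkCar (suc p) c (holes l ++ R)) (suc c) k) (cong suc q≡p+1+j) ⟩
      completions (parkCar (suc p) c (holes (suc p + suc j) ++ R)) (suc c) k
        ≡⟨ cong (λ l → completions l (suc c) k) (parkCar-holes (suc p) j c R) ⟩
      completions (holes (suc p) ++ just c ∷ holes j ++ R) (suc c) k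
        ≡⟨ completionsHoles k p (just c ∷ holes j ++ R) remaining car
             (n<1+n c ∷ All.map m<n⇒m<1+n (belowHoles j)) (Descending-∷ (belowHoles j) (desc′ j)) size′ ⟩
      3 ↑ p * holeWeight (2 + p) (holes j ++ R)
        ≡⟨ cong (3 ↑ p *_) (holeWeight-holes (2 + p) j R) ⟩
      3 ↑ p * ((3 + p) ↑ j * holeWeight (2 + p + j) R)
        ≡⟨ *-assoc (3 ↑ p) _ _ ⟨
      3 ↑ p * (3 + p) ↑ j * holeWeight (2 + p + j) R
        ≡⟨ cong₂ _*_ (↑-+ 3 p j) (cong (λ l → holeWeight l R) (arith₃ p j)) ⟨
      3 ↑ (p + j) * holeWeight (suc (p + suc j)) R
        ≡⟨ cong (λ l → 3 ↑ pred l * holeWeight (suc (p + suc j)) R) (+-suc p j) ⟨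
      3 ↑ pred (p + suc j) * holeWeight (suc (p + suc j)) R
        ≡⟨ cong (λ l → 3 ↑ pred l * holeWeight (suc l) R) q≡p+1+j ⟨
      3 ↑ pred q * holeWeight (suc q) R ∎
      where
      arith₁ : ∀ p j h → p + suc j + h ≡ suc p + (j + h)
      arith₁ = solve-∀
      arith₂ : ∀ p j l → suc p + suc (j + l) ≡ suc (p + suc j) + l
      arith₂ = solve-∀
      arith₃ : ∀ p j → suc (p + suc j) ≡ 2 + p + j
      arith₃ = solve-∀
      remaining : k ≡ suc p + countHoles (holes j ++ R)
      remaining = begin
        k                                   ≡⟨ k≡′ ⟩
        q + countHoles R                    ≡⟨ cong (_+ countHoles R) q≡p+1+j ⟩
        p + suc j + countHoles R            ≡⟨ arith₁ p j (countHoles R) ⟩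
        suc p + (j + countHoles R)          ≡⟨ cong (suc p +_) (countHoles-holes j R) ⟨
        suc p + countHoles (holes j ++ R)   ∎
      size′ : suc p + length (just c ∷ holes j ++ R) ≡ n
      size′ = begin
        suc p + suc (length (holes j ++ R)) ≡⟨ cong (λ l → suc p + suc l) (length-holes j R) ⟩
        suc p + suc (j + length R)          ≡⟨ arith₂ p j (length R) ⟩
        suc (p + suc j) + length R          ≡⟨ cong (λ l → suc l + length R) q≡p+1+j ⟨
        suc q + length R                    ≡⟨ size ⟩
        n                                   ∎

  completions-R : ∀ k → n ≡ suc k → completions (holes n) 0 n ≡ 3 ↑ k
  completions-R k refl = begin
    completions (holes (suc k)) 0 (suc k)       ≡⟨ cong (λ l → completions l 0 (suc k)) (++-identityʳ (holes (suc k))) ⟨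
    completions (holes (suc k) ++ []) 0 (suc k)
      ≡⟨ completionsHoles (suc k) k [] (sym (+-identityʳ (suc k))) empty [] (λ ()) (+-identityʳ (suc k)) ⟩
    3 ↑ k * 1                                   ≡⟨ *-identityʳ (3 ↑ k) ⟩
    3 ↑ k                                       ∎
    where open ≡-Reasoning

mainTheorem12 : (n : ℕ) → 1 ≤ n →
    (pk n (p132 ∷ p231 ∷ []) ≡ (suc n) ! / 2) ×
    (pk n (p132 ∷ p312 ∷ []) ≡ (suc n) ! / 2) ×
    (pk n (p231 ∷ p312 ∷ []) ≡ (suc n) ! / 2)
mainTheorem12 (suc k) (s≤s z≤n) =
    count (p132 ∷ p231 ∷ []) (CompletionsV.completions-V (suc k) k refl)
  , count (p132 ∷ p312 ∷ []) (CompletionsR.completions-R (suc k) k refl)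
  , count (p231 ∷ p312 ∷ []) (CompletionsL.completions-L (suc k) k refl)
  where
  count : ∀ σs → Completions.completions (suc k) σs (holes (suc k)) 0 (suc k) ≡ 3 ↑ k →
          pk (suc k) σs ≡ (2 + k) ! / 2
  count σs total = trans (Completions.pk≡completions (suc k) σs) (trans total (sym ([2+k]!/2≡3↑k k)))
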